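{- Let $\Theta\vdash P::\Delta\rho$ and $\Theta',p:\Delta\vdash Q::\Gamma$ be derivable in CHOP, where $P$ and $Q$ are chop-free. Then there exists a chop-free process $R$ such that $\Theta,\Theta'\vdash R::\Gamma$ is derivable.
   Context: CHOP (Classical Higher-Order Processes). Channel names $x,y,z,\dots$; process variables $p,q,r$; parameter labels $l$ (constants); type variables $X$. A parameter record $\rho=\{l_1=x_1,\dots,l_k=x_k\}$ maps distinct labels to channel names. Processes: $P,Q,R ::= x[y].(P\mid Q)\mid x(y).P\mid x[\mathsf{inl}].P\mid x[\mathsf{inr}].P\mid x.\mathsf{case}(P,Q)\mid ?x[y].P\mid !x(y).P\mid x[A].P\mid x(X).P\mid x[\lambda\rho.P]$ (send the abstraction $\lambda\rho.P$, which binds the names in the image of $\rho$; that image must be exactly the free channel names of $P$) $\mid x(p).P$ (receive an abstraction into $p$, bound in $P$) $\mid p\langle\rho\rangle$ (run) $\mid x[\,]\mid x().P\mid x.\mathsf{case}()\mid x\leftrightarrow^A y$ (link) $\mid(\nu x^A y)(P\mid Q)$ (parallel composition, $x$ bound in $P$, $y$ in $Q$) $\mid \mathsf{let}\ p=\lambda\rho.Q\ \mathsf{in}\ P$ (explicit substitution, $p$ bound in $P$). In $x[y].(P\mid Q)$, $x(y).P$, $?x[y].P$, $!x(y).P$ the name $y$ is bound in the continuation $P$; in $x(X).P$, $X$ is bound. Processes are up to $\alpha$-equivalence. Session types: $A,B::=A\otimes B\mid A⅋B\mid A\oplus B\mid A\&B\mid 0\mid\top\mid1\mid\bot\mid ?A\mid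 !A\mid\exists X.A\mid\forall X.A\mid X\mid X^\perp\mid\mathsf{send}(\Gamma)\mid\mathsf{recv}(\Gamma)$, where a process type $\Gamma=s_1:A_1,\dots,s_n:A_n$ maps distinct keys (all labels or all channels) to session types, order irrelevant; $\Gamma,\Delta$ is the union of disjoint $\Gamma,\Delta$. Duality $A^\perp$: $(X)^\perp=X^\perp$, $(X^\perp)^\perp=X$, $\otimes/⅋$, $\oplus/\&$, $0/\top$, $1/\bot$, $?/!$, $\exists/\forall$ are swapped componentwise ($(A\otimes B)^\perp=A^\perp⅋B^\perp$, $(?A)^\perp=!(A^\perp)$, $(\exists X.A)^\perp=\forall X.A^\perp$, etc.), and $\mathsf{send}(\Gamma)^\perp=\mathsf{recv}(\Gamma)$, $\mathsf{recv}(\Gamma)^\perp=\mathsf{send}(\Gamma)$. $\Gamma\rho$ is $\Gamma$ with each label $l$ replaced by $\rho(l)$; $?\Gamma$ means every type in $\Gamma$ has the form $?A$. A process environment $\Theta=p_1:\Gamma_1,\dots,p_n:\Gamma_n$ has distinct variables; $\cdot$ is empty. Typing rules for $\Theta\vdash P::\Gamma$: (Axiom) $\cdot\vdash x\leftrightarrow^A y::x:A^\perp,y:A$. (Cut) $\Theta\vdash P::\Gamma,x:A$ and $\Theta'\vdash Q::\Delta,y:A^\perp$ give $\Theta,\Theta'\vdash(\nu x^Ay)(P\mid Q)::\Gamma,\Delta$. ($\otimes$) $\Theta\vdash P::\Gamma,y:A$ and $\Theta'\vdash Q::\Delta,x:B$ give $\Theta,\Theta'\vdash x[y].(P\mid Q)::\Gamma,\Delta,x:A\otimes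 B$. ($⅋$) $\Theta\vdash P::\Gamma,y:A,x:B$ gives $\Theta\vdash x(y).P::\Gamma,x:A⅋B$. ($\oplus_1$,$\oplus_2$) $\Theta\vdash P::\Gamma,x:A$ (resp. $x:B$) gives $\Theta\vdash x[\mathsf{inl}].P$ (resp. $x[\mathsf{inr}].P$) $::\Gamma,x:A\oplus B$. ($\&$) $\Theta\vdash P::\Gamma,x:A$ and $\Theta\vdash Q::\Gamma,x:B$ give $\Theta\vdash x.\mathsf{case}(P,Q)::\Gamma,x:A\&B$. ($?$) $\Theta\vdash P::\Gamma,y:A$ gives $\Theta\vdash ?x[y].P::\Gamma,x:?A$. ($!$) $\cdot\vdash P::?\Gamma,y:A$ gives $\cdot\vdash !x(y).P::?\Gamma,x:!A$. ($\exists$) $\Theta\vdash P::\Gamma,x:B\{A/X\}$ gives $\Theta\vdash x[A].P::\Gamma,x:\exists X.B$. ($\forall$) $\Theta\vdash P::\Gamma,x:B$, $X$ not free in $\Theta,\Gamma$, gives $\Theta\vdash x(X).P::\Gamma,x:\forall X.B$. (Weaken) $\Theta\vdash P::\Gamma$ gives $\Theta\vdash P::\Gamma,x:?A$. (Contract) $\Theta\vdash P::\Gamma,y:?A,z:?A$ gives $\Theta\vdash P\{x/y,x/z\}::\Gamma,x:?A$. ($1$) $\cdot\vdash x[\,]::x:1$. ($\bot$) $\Theta\vdash P::\Gamma$ gives $\Theta\vdash x().P::\Gamma,x:\bot$. ($\top$) $\Theta\vdash x.\mathsf{case}()::\Gamma,x:\top$. (No rule for $0$.) (Id) $p:\Gamma\vdash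 p\langle\rho\rangle::\Gamma\rho$. (Chop) $\Theta\vdash P::\Delta\rho$ and $\Theta',p:\Delta\vdash Q::\Gamma$ give $\Theta,\Theta'\vdash\mathsf{let}\ p=\lambda\rho.P\ \mathsf{in}\ Q::\Gamma$. ($\mathsf{send}$) $\Theta\vdash P::\Gamma\rho$ gives $\Theta\vdash x[\lambda\rho.P]::x:\mathsf{send}(\Gamma)$. ($\mathsf{recv}$) $\Theta,p:\Delta\vdash P::\Gamma$ gives $\Theta\vdash x(p).P::\Gamma,x:\mathsf{recv}(\Delta)$. A process is chop-free if its typing derivation contains no application of rule Chop. -}

module Defs where

-- Conventions:
--  * Channel names, process variables and type variables are atoms (ℕ) when free
--    and de Bruijn indices when bound ("locally nameless"), so that processes and
--    types are identified up to α-equivalence by construction.  Three separate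
--    name spaces (channels / process variables / type variables).
--  * Parameter labels are ℕ.  Label-keyed process types (inside send/recv and in
--    process environments) are kept in canonical form: strictly sorted by label.
--    Channel-keyed process types and process environments are lists; the
--    irrelevance of order is expressed by the exchange rule (permutations).
--  * Typing rules with a bound name use the "exists-fresh" formulation.
--  * The judgement is indexed by a Bool c; the Chop rule exists only for
--    c = true.  A chop-free derivation is a derivation at c = false.

open import Data.Nat using (ℕ; zero; suc; _<_; _≡ᵇ_; _≤ᵇ_; _∸_)
open import Data.Bool using (Bool; true; false; if_then_else_)
open import Data.Product using (_×_; _,_; proj₁; proj₂; ∃)
open import Data.List using (List; []; _∷_; _++_; map; zip)
open import Data.List.Membership.Propositional using (_∈_; _∉_)
open import Data.List.Relation.Unary.All using (All)
open import Data.List.Relation.Unary.Unique.Propositional using (Unique)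
open import Data.List.Relation.Binary.Permutation.Propositional using (_↭_)
open import Relation.Binary.PropositionalEquality using (_≡_; _≢_)

Atom : Set
Atom = ℕ

Label : Set
Label = ℕ

data Nm : Set where
  fv : Atom → Nm
  bv : ℕ → Nm

infixr 6 _⊗_ _⅋_
infixr 5 _⊕_ _&_

data Ty : Set where
  _⊗_ _⅋_ _⊕_ _&_ : Ty → Ty → Ty
  Zero Top One Bot : Ty
  ⁇_ ‼_ : Ty → Ty
  ∃ᵗ ∀ᵗ : Ty → Ty                 -- ∃X.A , ∀X.A  (binds type index 0)
  var dvar : Nm → Ty              -- X , X^⊥
  send recv : List (Label × Ty) → Ty

LCtx : Set
LCtx = List (Label × Ty)

CCtx : Set
CCtx = List (Atom × Ty)

PEnv : Set
PEnv = List (Atom × LCtx)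

keys : {A B : Set} → List (A × B) → List A
keys = map proj₁

UniqK : {A B : Set} → List (A × B) → Set
UniqK Γ = Unique (keys Γ)

-- disjointness of domains (Γ,Δ is only defined for disjoint Γ, Δ)
Disj : {A B : Set} → List (A × B) → List (A × B) → Set
Disj Γ Δ = ∀ {k} → k ∈ keys Γ → k ∉ keys Δ

dual : Ty → Ty
dual (A ⊗ B) = dual A ⅋ dual B
dual (A ⅋ B) = dual A ⊗ dual B
dual (A ⊕ B) = dual A & dual B
dual (A & B) = dual A ⊕ dual B
dual Zero = Top
dual Top = Zero
dual One = Bot
dual Bot = One
dual (⁇ A) = ‼ dual A
dual (‼ A) = ⁇ dual A
dual (∃ᵗ A) = ∀ᵗ (dual A)
dual (∀ᵗ A) = ∃ᵗ (dual A)
dual (var X) = dvar X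
dual (dvar X) = var X
dual (send Γ) = recv Γ
dual (recv Γ) = send Γ

-- substitution of a (locally closed) type for the bound type index k:
-- openTy k A B = B{A/X}, where X^⊥ becomes A^⊥
mutual
  openTy : ℕ → Ty → Ty → Ty
  openTy k A (B ⊗ C) = openTy k A B ⊗ openTy k A C
  openTy k A (B ⅋ C) = openTy k A B ⅋ openTy k A C
  openTy k A (B ⊕ C) = openTy k A B ⊕ openTy k A C
  openTy k A (B & C) = openTy k A B & openTy k A C
  openTy k A Zero = Zero
  openTy k A Top = Top
  openTy k A One = One
  openTy k A Bot = Bot
  openTy k A (⁇ B) = ⁇ openTy k A B
  openTy k A (‼ B) = ‼ openTy k A B
  openTy k A (∃ᵗ B) = ∃ᵗ (openTy (suc k) A B)
  openTy k A (∀ᵗ B) = ∀ᵗ (openTy (suc k) A B)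
  openTy k A (var (fv a)) = var (fv a)
  openTy k A (var (bv j)) = if j ≡ᵇ k then A else var (bv j)
  openTy k A (dvar (fv a)) = dvar (fv a)
  openTy k A (dvar (bv j)) = if j ≡ᵇ k then dual A else dvar (bv j)
  openTy k A (send Γ) = send (openTys k A Γ)
  openTy k A (recv Γ) = recv (openTys k A Γ)

  openTys : ℕ → Ty → LCtx → LCtx
  openTys k A [] = []
  openTys k A ((l , B) ∷ Γ) = (l , openTy k A B) ∷ openTys k A Γ

ftvN : Nm → List Atom
ftvN (fv a) = a ∷ []
ftvN (bv _) = []

mutual
  ftvT : Ty → List Atom
  ftvT (A ⊗ B) = ftvT A ++ ftvT B
  ftvT (A ⅋ B) = ftvT A ++ ftvT B
  ftvT (A ⊕ B) = ftvT A ++ ftvT B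
  ftvT (A & B) = ftvT A ++ ftvT B
  ftvT Zero = []
  ftvT Top = []
  ftvT One = []
  ftvT Bot = []
  ftvT (⁇ A) = ftvT A
  ftvT (‼ A) = ftvT A
  ftvT (∃ᵗ A) = ftvT A
  ftvT (∀ᵗ A) = ftvT A
  ftvT (var X) = ftvN X
  ftvT (dvar X) = ftvN X
  ftvT (send Γ) = ftvL Γ
  ftvT (recv Γ) = ftvL Γ

  ftvL : LCtx → List Atom
  ftvL [] = []
  ftvL ((_ , A) ∷ Γ) = ftvT A ++ ftvL Γ

ftvC : CCtx → List Atom
ftvC [] = []
ftvC ((_ , A) ∷ Γ) = ftvT A ++ ftvC Γ

ftvE : PEnv → List Atom
ftvE [] = []
ftvE ((_ , Δ) ∷ Θ) = ftvL Δ ++ ftvE Θ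

mutual
  data WfT (k : ℕ) : Ty → Set where
    w⊗ : ∀ {A B} → WfT k A → WfT k B → WfT k (A ⊗ B)
    w⅋ : ∀ {A B} → WfT k A → WfT k B → WfT k (A ⅋ B)
    w⊕ : ∀ {A B} → WfT k A → WfT k B → WfT k (A ⊕ B)
    w& : ∀ {A B} → WfT k A → WfT k B → WfT k (A & B)
    w0 : WfT k Zero
    w⊤ : WfT k Top
    w1 : WfT k One
    w⊥ : WfT k Bot
    w? : ∀ {A} → WfT k A → WfT k (⁇ A)
    w! : ∀ {A} → WfT k A → WfT k (‼ A)
    w∃ : ∀ {A} → WfT (suc k) A → WfT k (∃ᵗ A)
    w∀ : ∀ {A} → WfT (suc k) A → WfT k (∀ᵗ A)
    wvf : ∀ {a} → WfT k (var (fv a))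
    wvb : ∀ {j} → j < k → WfT k (var (bv j))
    wdf : ∀ {a} → WfT k (dvar (fv a))
    wdb : ∀ {j} → j < k → WfT k (dvar (bv j))
    wsend : ∀ {Γ} → WfL k Γ → WfT k (send Γ)
    wrecv : ∀ {Γ} → WfL k Γ → WfT k (recv Γ)

  data WfL (k : ℕ) : LCtx → Set where
    [] : WfL k []
    cons : ∀ {l A Γ} → WfT k A → All (λ e → l < proj₁ e) Γ → WfL k Γ
         → WfL k ((l , A) ∷ Γ)

WfC : CCtx → Set
WfC Γ = All (λ e → WfT 0 (proj₂ e)) Γ

WfE : PEnv → Set
WfE Θ = All (λ e → WfL 0 (proj₂ e)) Θ

AllWhy : CCtx → Set
AllWhy Γ = All (λ e → ∃ λ A → proj₂ e ≡ ⁇ A) Γ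

-- Γρ : application of a parameter record (canonical, sorted like Δ) to a
-- label-keyed process type; Δ · ρ ≡ Γ means Γ = Δρ (domains of Δ and ρ agree)
data _·_≡_ : LCtx → List (Label × Atom) → CCtx → Set where
  [] : [] · [] ≡ []
  step : ∀ {l A x Δ ρ Γ} → Δ · ρ ≡ Γ → ((l , A) ∷ Δ) · ((l , x) ∷ ρ) ≡ ((x , A) ∷ Γ)

data Proc : Set where
  out    : Nm → Proc → Proc → Proc           -- x[y].(P | Q)   (binds 1 channel in P)
  inp    : Nm → Proc → Proc                  -- x(y).P         (binds 1 channel)
  selL   : Nm → Proc → Proc
  selR   : Nm → Proc → Proc
  caseP  : Nm → Proc → Proc → Proc
  whyP   : Nm → Proc → Proc                  -- ?x[y].P        (binds 1 channel)
  bangP  : Nm → Proc → Proc                  -- !x(y).P        (binds 1 channel)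
  tsend  : Nm → Ty → Proc → Proc
  trecv  : Nm → Proc → Proc                  -- x(X).P         (binds 1 type var)
  asend  : Nm → List Label → Proc → Proc     -- x[λρ.P]  ρ = {lᵢ = i-th bound channel}
  arecv  : Nm → Proc → Proc                  -- x(p).P         (binds 1 process var)
  run    : Nm → List (Label × Nm) → Proc     -- p⟨ρ⟩  (first Nm is a process variable)
  closeP : Nm → Proc
  waitP  : Nm → Proc → Proc
  caseE  : Nm → Proc
  link   : Nm → Ty → Nm → Proc
  nu     : Ty → Proc → Proc → Proc           -- (ν x^A y)(P | Q)  (binds 1 channel in each)
  lett   : List Label → Proc → Proc → Proc   -- let p = λρ.P in Q
                                             --   (binds |ρ| channels in P, 1 process var in Q)

idx : ℕ → List Atom → Nm → Nm
idx _ [] d = d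
idx zero (y ∷ _) _ = fv y
idx (suc i) (_ ∷ ys) d = idx i ys d

openN : ℕ → List Atom → Nm → Nm
openN k ys (fv a) = fv a
openN k ys (bv j) = if k ≤ᵇ j then idx (j ∸ k) ys (bv j) else bv j

openR : ℕ → List Atom → List (Label × Nm) → List (Label × Nm)
openR k ys [] = []
openR k ys ((l , x) ∷ ρ) = (l , openN k ys x) ∷ openR k ys ρ

len : {A : Set} → List A → ℕ
len [] = 0
len (_ ∷ xs) = suc (len xs)

openC : ℕ → List Atom → Proc → Proc
openC k ys (out x P Q) = out (openN k ys x) (openC (suc k) ys P) (openC k ys Q)
openC k ys (inp x P) = inp (openN k ys x) (openC (suc k) ys P)
openC k ys (selL x P) = selL (openN k ys x) (openC k ys P)
openC k ys (selR x P) = selR (openN k ys x) (openC k ys P)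
openC k ys (caseP x P Q) = caseP (openN k ys x) (openC k ys P) (openC k ys Q)
openC k ys (whyP x P) = whyP (openN k ys x) (openC (suc k) ys P)
openC k ys (bangP x P) = bangP (openN k ys x) (openC (suc k) ys P)
openC k ys (tsend x A P) = tsend (openN k ys x) A (openC k ys P)
openC k ys (trecv x P) = trecv (openN k ys x) (openC k ys P)
openC k ys (asend x ls P) = asend (openN k ys x) ls (openC (len ls Data.Nat.+ k) ys P)
openC k ys (arecv x P) = arecv (openN k ys x) (openC k ys P)
openC k ys (run p ρ) = run p (openR k ys ρ)
openC k ys (closeP x) = closeP (openN k ys x)
openC k ys (waitP x P) = waitP (openN k ys x) (openC k ys P)
openC k ys (caseE x) = caseE (openN k ys x)
openC k ys (link x A y) = link (openN k ys x) A (openN k ys y)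
openC k ys (nu A P Q) = nu A (openC (suc k) ys P) (openC (suc k) ys Q)
openC k ys (lett ls P Q) = lett ls (openC (len ls Data.Nat.+ k) ys P) (openC k ys Q)

_^_ : Proc → Atom → Proc
P ^ y = openC 0 (y ∷ []) P

openTP : ℕ → Ty → Proc → Proc
openTP k A (out x P Q) = out x (openTP k A P) (openTP k A Q)
openTP k A (inp x P) = inp x (openTP k A P)
openTP k A (selL x P) = selL x (openTP k A P)
openTP k A (selR x P) = selR x (openTP k A P)
openTP k A (caseP x P Q) = caseP x (openTP k A P) (openTP k A Q)
openTP k A (whyP x P) = whyP x (openTP k A P)
openTP k A (bangP x P) = bangP x (openTP k A P)
openTP k A (tsend x B P) = tsend x (openTy k A B) (openTP k A P)
openTP k A (trecv x P) = trecv x (openTP (suc k) A P)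
openTP k A (asend x ls P) = asend x ls (openTP k A P)
openTP k A (arecv x P) = arecv x (openTP k A P)
openTP k A (run p ρ) = run p ρ
openTP k A (closeP x) = closeP x
openTP k A (waitP x P) = waitP x (openTP k A P)
openTP k A (caseE x) = caseE x
openTP k A (link x B y) = link x (openTy k A B) y
openTP k A (nu B P Q) = nu (openTy k A B) (openTP k A P) (openTP k A Q)
openTP k A (lett ls P Q) = lett ls (openTP k A P) (openTP k A Q)

openPN : ℕ → Atom → Nm → Nm
openPN k p (fv a) = fv a
openPN k p (bv j) = if j ≡ᵇ k then fv p else bv j

openPV : ℕ → Atom → Proc → Proc
openPV k p (out x P Q) = out x (openPV k p P) (openPV k p Q)
openPV k p (inp x P) = inp x (openPV k p P)
openPV k p (selL x P) = selL x (openPV k p P)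
openPV k p (selR x P) = selR x (openPV k p P)
openPV k p (caseP x P Q) = caseP x (openPV k p P) (openPV k p Q)
openPV k p (whyP x P) = whyP x (openPV k p P)
openPV k p (bangP x P) = bangP x (openPV k p P)
openPV k p (tsend x B P) = tsend x B (openPV k p P)
openPV k p (trecv x P) = trecv x (openPV k p P)
openPV k p (asend x ls P) = asend x ls (openPV k p P)
openPV k p (arecv x P) = arecv x (openPV (suc k) p P)
openPV k p (run q ρ) = run (openPN k p q) ρ
openPV k p (closeP x) = closeP x
openPV k p (waitP x P) = waitP x (openPV k p P)
openPV k p (caseE x) = caseE x
openPV k p (link x B y) = link x B y
openPV k p (nu B P Q) = nu B (openPV k p P) (openPV k p Q)
openPV k p (lett ls P Q) = lett ls (openPV k p P) (openPV (suc k) p Q)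

-- renaming of the free channel atom y to x  (P{x/y}; capture is impossible)
renN : Atom → Atom → Nm → Nm
renN x y (fv a) = if a ≡ᵇ y then fv x else fv a
renN x y (bv j) = bv j

renR : Atom → Atom → List (Label × Nm) → List (Label × Nm)
renR x y [] = []
renR x y ((l , z) ∷ ρ) = (l , renN x y z) ∷ renR x y ρ

renC : Atom → Atom → Proc → Proc
renC x y (out z P Q) = out (renN x y z) (renC x y P) (renC x y Q)
renC x y (inp z P) = inp (renN x y z) (renC x y P)
renC x y (selL z P) = selL (renN x y z) (renC x y P)
renC x y (selR z P) = selR (renN x y z) (renC x y P)
renC x y (caseP z P Q) = caseP (renN x y z) (renC x y P) (renC x y Q)
renC x y (whyP z P) = whyP (renN x y z) (renC x y P)
renC x y (bangP z P) = bangP (renN x y z) (renC x y P)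
renC x y (tsend z A P) = tsend (renN x y z) A (renC x y P)
renC x y (trecv z P) = trecv (renN x y z) (renC x y P)
renC x y (asend z ls P) = asend (renN x y z) ls (renC x y P)
renC x y (arecv z P) = arecv (renN x y z) (renC x y P)
renC x y (run p ρ) = run p (renR x y ρ)
renC x y (closeP z) = closeP (renN x y z)
renC x y (waitP z P) = waitP (renN x y z) (renC x y P)
renC x y (caseE z) = caseE (renN x y z)
renC x y (link z A w) = link (renN x y z) A (renN x y w)
renC x y (nu A P Q) = nu A (renC x y P) (renC x y Q)
renC x y (lett ls P Q) = lett ls (renC x y P) (renC x y Q)

fvN : Nm → List Atom
fvN (fv a) = a ∷ []
fvN (bv _) = []

fvR : List (Label × Nm) → List Atom
fvR [] = []
fvR ((_ , x) ∷ ρ) = fvN x ++ fvR ρ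

fvC : Proc → List Atom
fvC (out x P Q) = fvN x ++ fvC P ++ fvC Q
fvC (inp x P) = fvN x ++ fvC P
fvC (selL x P) = fvN x ++ fvC P
fvC (selR x P) = fvN x ++ fvC P
fvC (caseP x P Q) = fvN x ++ fvC P ++ fvC Q
fvC (whyP x P) = fvN x ++ fvC P
fvC (bangP x P) = fvN x ++ fvC P
fvC (tsend x A P) = fvN x ++ fvC P
fvC (trecv x P) = fvN x ++ fvC P
fvC (asend x ls P) = fvN x ++ fvC P
fvC (arecv x P) = fvN x ++ fvC P
fvC (run p ρ) = fvR ρ
fvC (closeP x) = fvN x
fvC (waitP x P) = fvN x ++ fvC P
fvC (caseE x) = fvN x
fvC (link x A y) = fvN x ++ fvN y
fvC (nu A P Q) = fvC P ++ fvC Q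
fvC (lett ls P Q) = fvC P ++ fvC Q

ftvP : Proc → List Atom
ftvP (out x P Q) = ftvP P ++ ftvP Q
ftvP (inp x P) = ftvP P
ftvP (selL x P) = ftvP P
ftvP (selR x P) = ftvP P
ftvP (caseP x P Q) = ftvP P ++ ftvP Q
ftvP (whyP x P) = ftvP P
ftvP (bangP x P) = ftvP P
ftvP (tsend x A P) = ftvT A ++ ftvP P
ftvP (trecv x P) = ftvP P
ftvP (asend x ls P) = ftvP P
ftvP (arecv x P) = ftvP P
ftvP (run p ρ) = []
ftvP (closeP x) = []
ftvP (waitP x P) = ftvP P
ftvP (caseE x) = []
ftvP (link x A y) = ftvT A
ftvP (nu A P Q) = ftvT A ++ ftvP P ++ ftvP Q
ftvP (lett ls P Q) = ftvP P ++ ftvP Q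

fpv : Proc → List Atom
fpv (out x P Q) = fpv P ++ fpv Q
fpv (inp x P) = fpv P
fpv (selL x P) = fpv P
fpv (selR x P) = fpv P
fpv (caseP x P Q) = fpv P ++ fpv Q
fpv (whyP x P) = fpv P
fpv (bangP x P) = fpv P
fpv (tsend x A P) = fpv P
fpv (trecv x P) = fpv P
fpv (asend x ls P) = fpv P
fpv (arecv x P) = fpv P
fpv (run p ρ) = fvN p
fpv (closeP x) = []
fpv (waitP x P) = fpv P
fpv (caseE x) = []
fpv (link x A y) = []
fpv (nu A P Q) = fpv P ++ fpv Q
fpv (lett ls P Q) = fpv P ++ fpv Q

fvRec : List (Label × Atom) → List (Label × Nm)
fvRec [] = []
fvRec ((l , x) ∷ ρ) = (l , fv x) ∷ fvRec ρ

infix 3 _⊢[_]_⦂_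

data _⊢[_]_⦂_ : PEnv → Bool → Proc → CCtx → Set where

  ax : ∀ {c x y A} → x ≢ y → WfT 0 A
     → [] ⊢[ c ] link (fv x) A (fv y) ⦂ (x , dual A) ∷ (y , A) ∷ []

  cut : ∀ {c Θ Θ' Γ Δ A P Q} (x y : Atom) → x ∉ fvC P → y ∉ fvC Q
      → Disj Γ Δ → Disj Θ Θ'
      → Θ ⊢[ c ] P ^ x ⦂ Γ ++ (x , A) ∷ []
      → Θ' ⊢[ c ] Q ^ y ⦂ Δ ++ (y , dual A) ∷ []
      → Θ ++ Θ' ⊢[ c ] nu A P Q ⦂ Γ ++ Δ

  tensor : ∀ {c Θ Θ' Γ Δ A B P Q x} (y : Atom) → y ∉ fvC P
         → x ∉ keys Γ → Disj Γ Δ → Disj Θ Θ'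
         → Θ ⊢[ c ] P ^ y ⦂ Γ ++ (y , A) ∷ []
         → Θ' ⊢[ c ] Q ⦂ Δ ++ (x , B) ∷ []
         → Θ ++ Θ' ⊢[ c ] out (fv x) P Q ⦂ Γ ++ Δ ++ (x , A ⊗ B) ∷ []

  par : ∀ {c Θ Γ A B P x} (y : Atom) → y ∉ fvC P
      → Θ ⊢[ c ] P ^ y ⦂ Γ ++ (y , A) ∷ (x , B) ∷ []
      → Θ ⊢[ c ] inp (fv x) P ⦂ Γ ++ (x , A ⅋ B) ∷ []

  plus₁ : ∀ {c Θ Γ A B P x} → WfT 0 B
        → Θ ⊢[ c ] P ⦂ Γ ++ (x , A) ∷ []
        → Θ ⊢[ c ] selL (fv x) P ⦂ Γ ++ (x , A ⊕ B) ∷ []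

  plus₂ : ∀ {c Θ Γ A B P x} → WfT 0 A
        → Θ ⊢[ c ] P ⦂ Γ ++ (x , B) ∷ []
        → Θ ⊢[ c ] selR (fv x) P ⦂ Γ ++ (x , A ⊕ B) ∷ []

  with& : ∀ {c Θ Γ A B P Q x}
        → Θ ⊢[ c ] P ⦂ Γ ++ (x , A) ∷ []
        → Θ ⊢[ c ] Q ⦂ Γ ++ (x , B) ∷ []
        → Θ ⊢[ c ] caseP (fv x) P Q ⦂ Γ ++ (x , A & B) ∷ []

  why : ∀ {c Θ Γ A P x} (y : Atom) → y ∉ fvC P → x ∉ keys Γ
      → Θ ⊢[ c ] P ^ y ⦂ Γ ++ (y , A) ∷ []
      → Θ ⊢[ c ] whyP (fv x) P ⦂ Γ ++ (x , ⁇ A) ∷ []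

  bang : ∀ {c Γ A P x} (y : Atom) → y ∉ fvC P → x ∉ keys Γ → AllWhy Γ
       → [] ⊢[ c ] P ^ y ⦂ Γ ++ (y , A) ∷ []
       → [] ⊢[ c ] bangP (fv x) P ⦂ Γ ++ (x , ‼ A) ∷ []

  ex∃ : ∀ {c Θ Γ A B P x} → WfT 0 A → WfT 1 B
         → Θ ⊢[ c ] P ⦂ Γ ++ (x , openTy 0 A B) ∷ []
         → Θ ⊢[ c ] tsend (fv x) A P ⦂ Γ ++ (x , ∃ᵗ B) ∷ []

  all∀ : ∀ {c Θ Γ B P x} (X : Atom) → X ∉ ftvP P → X ∉ ftvT B
         → X ∉ ftvE Θ → X ∉ ftvC Γ
         → Θ ⊢[ c ] openTP 0 (var (fv X)) P ⦂ Γ ++ (x , openTy 0 (var (fv X)) B) ∷ []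
         → Θ ⊢[ c ] trecv (fv x) P ⦂ Γ ++ (x , ∀ᵗ B) ∷ []

  weaken : ∀ {c Θ Γ A P x} → x ∉ keys Γ → WfT 0 A
         → Θ ⊢[ c ] P ⦂ Γ
         → Θ ⊢[ c ] P ⦂ Γ ++ (x , ⁇ A) ∷ []

  contract : ∀ {c Θ Γ A P x y z} → x ∉ keys Γ
           → Θ ⊢[ c ] P ⦂ Γ ++ (y , ⁇ A) ∷ (z , ⁇ A) ∷ []
           → Θ ⊢[ c ] renC x y (renC x z P) ⦂ Γ ++ (x , ⁇ A) ∷ []

  one : ∀ {c x} → [] ⊢[ c ] closeP (fv x) ⦂ (x , One) ∷ []

  bot : ∀ {c Θ Γ P x} → x ∉ keys Γ
      → Θ ⊢[ c ] P ⦂ Γ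
      → Θ ⊢[ c ] waitP (fv x) P ⦂ Γ ++ (x , Bot) ∷ []

  top : ∀ {c Θ Γ x} → UniqK Θ → WfE Θ → UniqK Γ → WfC Γ → x ∉ keys Γ
      → Θ ⊢[ c ] caseE (fv x) ⦂ Γ ++ (x , Top) ∷ []

  idP : ∀ {c Δ Γ p} (ρ : List (Label × Atom)) → WfL 0 Δ → Δ · ρ ≡ Γ → UniqK Γ
      → (p , Δ) ∷ [] ⊢[ c ] run (fv p) (fvRec ρ) ⦂ Γ

  chop : ∀ {Θ Θ' Γ Δ Γρ ls P Q} (ys : List Atom) (p : Atom)
       → Unique ys → All (λ y → y ∉ fvC P) ys → p ∉ fpv Q → Disj Θ Θ'
       → Δ · zip ls ys ≡ Γρ
       → Θ ⊢[ true ] openC 0 ys P ⦂ Γρ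
       → Θ' ++ (p , Δ) ∷ [] ⊢[ true ] openPV 0 p Q ⦂ Γ
       → Θ ++ Θ' ⊢[ true ] lett ls P Q ⦂ Γ

  sendR : ∀ {c Θ Δ Γρ ls P x} (ys : List Atom) → WfL 0 Δ
        → Unique ys → All (λ y → y ∉ fvC P) ys
        → Δ · zip ls ys ≡ Γρ
        → Θ ⊢[ c ] openC 0 ys P ⦂ Γρ
        → Θ ⊢[ c ] asend (fv x) ls P ⦂ (x , send Δ) ∷ []

  recvR : ∀ {c Θ Γ Δ P x} (p : Atom) → p ∉ fpv P → x ∉ keys Γ
        → Θ ++ (p , Δ) ∷ [] ⊢[ c ] openPV 0 p P ⦂ Γ
        → Θ ⊢[ c ] arecv (fv x) P ⦂ Γ ++ (x , recv Δ) ∷ []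

  exch : ∀ {c Θ Θ' Γ Γ' P} → Θ ↭ Θ' → Γ ↭ Γ'
       → Θ ⊢[ c ] P ⦂ Γ
       → Θ' ⊢[ c ] P ⦂ Γ'

-- Chop is admissible through a single cut: let p = λρ.P in Q is replaced by
-- (ν x^{send Δ} y)(x[λρ.P] | y(p).Q), whose two halves are typed by the send and
-- recv rules from the derivations of P and Q.  In the locally nameless encoding this
-- needs that abstracting the channels of ρ in P, and the variable p in Q, is undone by
-- opening them again, which holds because typable processes are locally closed.

module Submission where

open import Defs
open import Data.Bool using (true; false)
open import Data.Empty using (⊥-elim)
open import Data.Maybe using (Maybe; just; nothing)
open import Data.Nat using (ℕ; zero; suc; _<_; _≤_; _+_; _∸_; _≡ᵇ_; _≤ᵇ_; z≤n; s≤s)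
open import Data.Nat.Properties
open import Data.Product as Product using (_×_; _,_; proj₁; proj₂; ∃)
open import Data.Sum as Sum using (_⊎_; inj₁; inj₂)
open import Data.Unit using (⊤; tt)
open import Data.List using (List; []; _∷_; _++_; map; zip)
open import Data.List.Extrema.Nat using (max; xs≤max)
open import Data.List.Properties using (map-++)
open import Data.List.Membership.Propositional using (_∈_; _∉_)
open import Data.List.Membership.Propositional.Properties using (∈-++⁺ˡ; ∈-++⁺ʳ; ∈-++⁻)
open import Data.List.Relation.Unary.Any using (here; there)
open import Data.List.Relation.Unary.All as All using (All; []; _∷_)
import Data.List.Relation.Unary.All.Properties as AllP
open import Data.List.Relation.Unary.AllPairs using ([]; _∷_)
open import Data.List.Relation.Unary.Unique.Propositional using (Unique)
import Data.List.Relation.Unary.Unique.Propositional.Properties as UniqueP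
open import Data.List.Relation.Binary.Disjoint.Propositional using (Disjoint)
open import Data.List.Relation.Binary.Subset.Propositional using (_⊆_)
open import Data.List.Relation.Binary.Subset.Propositional.Properties using (++⁺; ∈-∷⁺ʳ)
open import Data.List.Relation.Binary.Permutation.Propositional using (↭⇒↭ₛ)
open import Data.List.Relation.Binary.Permutation.Propositional.Properties using (All-resp-↭; ∈-resp-↭)
  renaming (map⁺ to ↭-map⁺)
open import Function using (id; _∘_)
open import Relation.Binary.PropositionalEquality
open import Data.List.Relation.Binary.Permutation.Setoid.Properties (setoid Atom) using (Unique-resp-↭)
open import Relation.Nullary.Reflects using (Reflects; ofʸ; ofⁿ; fromEquivalence)

cong₃ : ∀ {A B C D : Set} (f : A → B → C → D) {a a' b b' c c'}
      → a ≡ a' → b ≡ b' → c ≡ c' → f a b c ≡ f a' b' c'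
cong₃ f refl refl refl = refl

≡ᵇ-reflects-≡ : ∀ m n → Reflects (m ≡ n) (m ≡ᵇ n)
≡ᵇ-reflects-≡ m n = fromEquivalence (≡ᵇ⇒≡ m n) (≡⇒≡ᵇ m n)

≡ᵇ-refl : ∀ m → (m ≡ᵇ m) ≡ true
≡ᵇ-refl zero = refl
≡ᵇ-refl (suc m) = ≡ᵇ-refl m

∉-++⁺ : ∀ {a : Atom} {A B} → a ∉ A → a ∉ B → a ∉ A ++ B
∉-++⁺ {A = A} a∉A a∉B a∈ with ∈-++⁻ A a∈
... | inj₁ a∈A = a∉A a∈A
... | inj₂ a∈B = a∉B a∈B

disjoint-++ˡ : ∀ {ws A B : List Atom} → Disjoint ws (A ++ B) → Disjoint ws A
disjoint-++ˡ d (w∈ , a∈) = d (w∈ , ∈-++⁺ˡ a∈)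

disjoint-++ʳ : ∀ {ws A B : List Atom} → Disjoint ws (A ++ B) → Disjoint ws B
disjoint-++ʳ {A = A} d (w∈ , b∈) = d (w∈ , ∈-++⁺ʳ A b∈)

disjoint-++⁻³ : ∀ {ws A B C : List Atom} → Disjoint ws (A ++ B ++ C)
              → Disjoint ws A × Disjoint ws B × Disjoint ws C
disjoint-++⁻³ {A = A} d = disjoint-++ˡ d , disjoint-++ˡ (disjoint-++ʳ {A = A} d) , disjoint-++ʳ (disjoint-++ʳ {A = A} d)

disjoint-++⁺ : ∀ {ws A B : List Atom} → Disjoint ws A → Disjoint ws B → Disjoint ws (A ++ B)
disjoint-++⁺ {A = A} dA dB (w∈ , a∈) with ∈-++⁻ A a∈
... | inj₁ a∈A = dA (w∈ , a∈A)
... | inj₂ a∈B = dB (w∈ , a∈B)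

lcN : ℕ → Nm → Set
lcN n (fv _) = ⊤
lcN n (bv j) = j < n

lcN-mono : ∀ {m n} x → lcN m x → m ≤ n → lcN n x
lcN-mono (fv _) _ _ = tt
lcN-mono (bv j) j<m m≤n = ≤-trans j<m m≤n

openN-id : ∀ {m k} ys x → lcN m x → m ≤ k → openN k ys x ≡ x
openN-id ys (fv a) _ _ = refl
openN-id {k = k} ys (bv j) j<m m≤k with k ≤ᵇ j | ≤ᵇ-reflects-≤ k j
... | true | ofʸ k≤j = ⊥-elim (<-irrefl refl (≤-trans (≤-trans j<m m≤k) k≤j))
... | false | _ = refl

data IdxView (i : ℕ) (zs ws : List Atom) (d : Nm) : Set where
  inside : i < len zs → IdxView i zs ws d
  beyond : ∀ {w} → w ∈ ws → idx i (zs ++ ws) d ≡ fv w → IdxView i zs ws d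
  default : idx i (zs ++ ws) d ≡ d → IdxView i zs ws d

idx-view : ∀ i zs ws d → IdxView i zs ws d
idx-view zero (z ∷ zs) ws d = inside (s≤s z≤n)
idx-view (suc i) (z ∷ zs) ws d with idx-view i zs ws d
... | inside lt = inside (s≤s lt)
... | beyond w∈ e = beyond w∈ e
... | default e = default e
idx-view i [] [] d = default refl
idx-view zero [] (w ∷ ws) d = beyond (here refl) refl
idx-view (suc i) [] (w ∷ ws) d with idx-view i [] ws d
... | beyond w∈ e = beyond (there w∈) e
... | default e = default e

lcN-openN⁻ : ∀ k zs ws x → lcN k (openN k (zs ++ ws) x)
           → Disjoint ws (fvN (openN k (zs ++ ws) x)) → lcN (k + len zs) x
lcN-openN⁻ k zs ws (fv a) _ _ = tt
lcN-openN⁻ k zs ws (bv j) lc ws#x with k ≤ᵇ j | ≤ᵇ-reflects-≤ k j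
... | false | _ = ≤-trans lc (m≤m+n k (len zs))
... | true | ofʸ k≤j with idx-view (j ∸ k) zs ws (bv j)
...   | inside lt = subst (_< k + len zs) (m+[n∸m]≡n k≤j) (+-monoʳ-< k lt)
...   | beyond w∈ e = ⊥-elim (ws#x (w∈ , subst (λ z → _ ∈ fvN z) (sym e) (here refl)))
...   | default e = ⊥-elim (<-irrefl refl (≤-trans (subst (lcN k) e lc) k≤j))

indexOf : List Atom → Atom → Maybe ℕ
indexOf [] a = nothing
indexOf (y ∷ ys) a with a ≡ᵇ y
... | true = just 0
... | false with indexOf ys a
...   | nothing = nothing
...   | just i = just (suc i)

data IndexOf (ys : List Atom) (a : Atom) : Maybe ℕ → Set where
  absent : a ∉ ys → IndexOf ys a nothing
  found : ∀ {i} → i < len ys → (∀ d → idx i ys d ≡ fv a) → IndexOf ys a (just i)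

indexOf-view : ∀ ys a → IndexOf ys a (indexOf ys a)
indexOf-view [] a = absent λ ()
indexOf-view (y ∷ ys) a with a ≡ᵇ y | ≡ᵇ-reflects-≡ a y
... | true | ofʸ refl = found (s≤s z≤n) (λ _ → refl)
... | false | ofⁿ a≢y with indexOf ys a | indexOf-view ys a
...   | nothing | absent a∉ys = absent λ { (here a≡y) → a≢y a≡y ; (there a∈ys) → a∉ys a∈ys }
...   | just i | found i<n idx≡a = found (s≤s i<n) idx≡a

closeN : ℕ → List Atom → Nm → Nm
closeN k ys (fv a) with indexOf ys a
... | nothing = fv a
... | just i = bv (k + i)
closeN k ys (bv j) = bv j

openN-closeN : ∀ k ys x → lcN k x → openN k ys (closeN k ys x) ≡ x
openN-closeN k ys (fv a) _ with indexOf ys a | indexOf-view ys a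
... | nothing | _ = refl
... | just i | found _ idx≡a with k ≤ᵇ k + i | ≤ᵇ-reflects-≤ k (k + i)
...   | true | _ rewrite m+n∸m≡n k i = idx≡a (bv (k + i))
...   | false | ofⁿ k≰k+i = ⊥-elim (k≰k+i (m≤m+n k i))
openN-closeN k ys (bv j) lc = openN-id ys (bv j) lc ≤-refl

closeN-lcN : ∀ k ys x → lcN k x → lcN (k + len ys) (closeN k ys x)
closeN-lcN k ys (fv a) _ with indexOf ys a | indexOf-view ys a
... | nothing | _ = tt
... | just i | found i<n _ = +-monoʳ-< k i<n
closeN-lcN k ys (bv j) lc = lcN-mono (bv j) lc (m≤m+n k (len ys))

closeN-fresh : ∀ k ys x → Disjoint ys (fvN (closeN k ys x))
closeN-fresh k ys (fv a) with indexOf ys a | indexOf-view ys a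
... | nothing | absent a∉ys = λ { (a∈ys , here refl) → a∉ys a∈ys }
... | just i | _ = λ ()
closeN-fresh k ys (bv j) = λ ()

closePN : ℕ → Atom → Nm → Nm
closePN k p (fv a) with a ≡ᵇ p
... | true = bv k
... | false = fv a
closePN k p (bv j) = bv j

openPN-closePN : ∀ k p q → lcN k q → openPN k p (closePN k p q) ≡ q
openPN-closePN k p (fv a) _ with a ≡ᵇ p | ≡ᵇ-reflects-≡ a p
... | true | ofʸ refl rewrite ≡ᵇ-refl k = refl
... | false | _ = refl
openPN-closePN k p (bv j) j<k with j ≡ᵇ k | ≡ᵇ-reflects-≡ j k
... | true | ofʸ refl = ⊥-elim (<-irrefl refl j<k)
... | false | _ = refl

closePN-fresh : ∀ k p q → p ∉ fvN (closePN k p q)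
closePN-fresh k p (fv a) p∈ with a ≡ᵇ p | ≡ᵇ-reflects-≡ a p
closePN-fresh k p (fv a) () | true | _
closePN-fresh k p (fv a) (here refl) | false | ofⁿ a≢p = a≢p refl
closePN-fresh k p (bv j) ()

lcN-openPN⁻ : ∀ k p q → lcN k (openPN k p q) → lcN (suc k) q
lcN-openPN⁻ k p (fv a) _ = tt
lcN-openPN⁻ k p (bv j) lc with j ≡ᵇ k | ≡ᵇ-reflects-≡ j k
... | true | ofʸ refl = ≤-refl
... | false | _ = m≤n⇒m≤1+n lc

-- Local closure and closing of processes

lcR : ℕ → List (Label × Nm) → Set
lcR n [] = ⊤
lcR n ((_ , x) ∷ ρ) = lcN n x × lcR n ρ

lcC : ℕ → Proc → Set
lcC n (out x P Q) = lcN n x × lcC (suc n) P × lcC n Q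
lcC n (inp x P) = lcN n x × lcC (suc n) P
lcC n (selL x P) = lcN n x × lcC n P
lcC n (selR x P) = lcN n x × lcC n P
lcC n (caseP x P Q) = lcN n x × lcC n P × lcC n Q
lcC n (whyP x P) = lcN n x × lcC (suc n) P
lcC n (bangP x P) = lcN n x × lcC (suc n) P
lcC n (tsend x A P) = lcN n x × lcC n P
lcC n (trecv x P) = lcN n x × lcC n P
lcC n (asend x ls P) = lcN n x × lcC (len ls + n) P
lcC n (arecv x P) = lcN n x × lcC n P
lcC n (run p ρ) = lcR n ρ
lcC n (closeP x) = lcN n x
lcC n (waitP x P) = lcN n x × lcC n P
lcC n (caseE x) = lcN n x
lcC n (link x A y) = lcN n x × lcN n y
lcC n (nu A P Q) = lcC (suc n) P × lcC (suc n) Q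
lcC n (lett ls P Q) = lcC (len ls + n) P × lcC n Q

lcPV : ℕ → Proc → Set
lcPV n (out x P Q) = lcPV n P × lcPV n Q
lcPV n (inp x P) = lcPV n P
lcPV n (selL x P) = lcPV n P
lcPV n (selR x P) = lcPV n P
lcPV n (caseP x P Q) = lcPV n P × lcPV n Q
lcPV n (whyP x P) = lcPV n P
lcPV n (bangP x P) = lcPV n P
lcPV n (tsend x A P) = lcPV n P
lcPV n (trecv x P) = lcPV n P
lcPV n (asend x ls P) = lcPV n P
lcPV n (arecv x P) = lcPV (suc n) P
lcPV n (run p ρ) = lcN n p
lcPV n (closeP x) = ⊤
lcPV n (waitP x P) = lcPV n P
lcPV n (caseE x) = ⊤
lcPV n (link x A y) = ⊤
lcPV n (nu A P Q) = lcPV n P × lcPV n Q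
lcPV n (lett ls P Q) = lcPV n P × lcPV (suc n) Q

closeR : ℕ → List Atom → List (Label × Nm) → List (Label × Nm)
closeR k ys [] = []
closeR k ys ((l , x) ∷ ρ) = (l , closeN k ys x) ∷ closeR k ys ρ

closeC : ℕ → List Atom → Proc → Proc
closeC k ys (out x P Q) = out (closeN k ys x) (closeC (suc k) ys P) (closeC k ys Q)
closeC k ys (inp x P) = inp (closeN k ys x) (closeC (suc k) ys P)
closeC k ys (selL x P) = selL (closeN k ys x) (closeC k ys P)
closeC k ys (selR x P) = selR (closeN k ys x) (closeC k ys P)
closeC k ys (caseP x P Q) = caseP (closeN k ys x) (closeC k ys P) (closeC k ys Q)
closeC k ys (whyP x P) = whyP (closeN k ys x) (closeC (suc k) ys P)
closeC k ys (bangP x P) = bangP (closeN k ys x) (closeC (suc k) ys P)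
closeC k ys (tsend x A P) = tsend (closeN k ys x) A (closeC k ys P)
closeC k ys (trecv x P) = trecv (closeN k ys x) (closeC k ys P)
closeC k ys (asend x ls P) = asend (closeN k ys x) ls (closeC (len ls + k) ys P)
closeC k ys (arecv x P) = arecv (closeN k ys x) (closeC k ys P)
closeC k ys (run p ρ) = run p (closeR k ys ρ)
closeC k ys (closeP x) = closeP (closeN k ys x)
closeC k ys (waitP x P) = waitP (closeN k ys x) (closeC k ys P)
closeC k ys (caseE x) = caseE (closeN k ys x)
closeC k ys (link x A y) = link (closeN k ys x) A (closeN k ys y)
closeC k ys (nu A P Q) = nu A (closeC (suc k) ys P) (closeC (suc k) ys Q)
closeC k ys (lett ls P Q) = lett ls (closeC (len ls + k) ys P) (closeC k ys Q)

closePV : ℕ → Atom → Proc → Proc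
closePV k p (out x P Q) = out x (closePV k p P) (closePV k p Q)
closePV k p (inp x P) = inp x (closePV k p P)
closePV k p (selL x P) = selL x (closePV k p P)
closePV k p (selR x P) = selR x (closePV k p P)
closePV k p (caseP x P Q) = caseP x (closePV k p P) (closePV k p Q)
closePV k p (whyP x P) = whyP x (closePV k p P)
closePV k p (bangP x P) = bangP x (closePV k p P)
closePV k p (tsend x B P) = tsend x B (closePV k p P)
closePV k p (trecv x P) = trecv x (closePV k p P)
closePV k p (asend x ls P) = asend x ls (closePV k p P)
closePV k p (arecv x P) = arecv x (closePV (suc k) p P)
closePV k p (run q ρ) = run (closePN k p q) ρ
closePV k p (closeP x) = closeP x
closePV k p (waitP x P) = waitP x (closePV k p P)
closePV k p (caseE x) = caseE x
closePV k p (link x B y) = link x B y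
closePV k p (nu B P Q) = nu B (closePV k p P) (closePV k p Q)
closePV k p (lett ls P Q) = lett ls (closePV k p P) (closePV (suc k) p Q)

lcR-mono : ∀ {m n} ρ → lcR m ρ → m ≤ n → lcR n ρ
lcR-mono [] _ _ = tt
lcR-mono ((_ , x) ∷ ρ) (lx , lρ) le = lcN-mono x lx le , lcR-mono ρ lρ le

lcC-mono : ∀ {m n} P → lcC m P → m ≤ n → lcC n P
lcC-mono (out x P Q) (lx , lP , lQ) le = lcN-mono x lx le , lcC-mono P lP (s≤s le) , lcC-mono Q lQ le
lcC-mono (inp x P) (lx , lP) le = lcN-mono x lx le , lcC-mono P lP (s≤s le)
lcC-mono (selL x P) (lx , lP) le = lcN-mono x lx le , lcC-mono P lP le
lcC-mono (selR x P) (lx , lP) le = lcN-mono x lx le , lcC-mono P lP le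
lcC-mono (caseP x P Q) (lx , lP , lQ) le = lcN-mono x lx le , lcC-mono P lP le , lcC-mono Q lQ le
lcC-mono (whyP x P) (lx , lP) le = lcN-mono x lx le , lcC-mono P lP (s≤s le)
lcC-mono (bangP x P) (lx , lP) le = lcN-mono x lx le , lcC-mono P lP (s≤s le)
lcC-mono (tsend x A P) (lx , lP) le = lcN-mono x lx le , lcC-mono P lP le
lcC-mono (trecv x P) (lx , lP) le = lcN-mono x lx le , lcC-mono P lP le
lcC-mono (asend x ls P) (lx , lP) le = lcN-mono x lx le , lcC-mono P lP (+-monoʳ-≤ (len ls) le)
lcC-mono (arecv x P) (lx , lP) le = lcN-mono x lx le , lcC-mono P lP le
lcC-mono (run p ρ) lρ le = lcR-mono ρ lρ le
lcC-mono (closeP x) lx le = lcN-mono x lx le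
lcC-mono (waitP x P) (lx , lP) le = lcN-mono x lx le , lcC-mono P lP le
lcC-mono (caseE x) lx le = lcN-mono x lx le
lcC-mono (link x A y) (lx , ly) le = lcN-mono x lx le , lcN-mono y ly le
lcC-mono (nu A P Q) (lP , lQ) le = lcC-mono P lP (s≤s le) , lcC-mono Q lQ (s≤s le)
lcC-mono (lett ls P Q) (lP , lQ) le = lcC-mono P lP (+-monoʳ-≤ (len ls) le) , lcC-mono Q lQ le

openR-id : ∀ {m k} ys ρ → lcR m ρ → m ≤ k → openR k ys ρ ≡ ρ
openR-id ys [] _ _ = refl
openR-id ys ((l , x) ∷ ρ) (lx , lρ) le = cong₂ (λ u v → (l , u) ∷ v) (openN-id ys x lx le) (openR-id ys ρ lρ le)

openC-id : ∀ {m k} ys P → lcC m P → m ≤ k → openC k ys P ≡ P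
openC-id ys (out x P Q) (lx , lP , lQ) le = cong₃ out (openN-id ys x lx le) (openC-id ys P lP (s≤s le)) (openC-id ys Q lQ le)
openC-id ys (inp x P) (lx , lP) le = cong₂ inp (openN-id ys x lx le) (openC-id ys P lP (s≤s le))
openC-id ys (selL x P) (lx , lP) le = cong₂ selL (openN-id ys x lx le) (openC-id ys P lP le)
openC-id ys (selR x P) (lx , lP) le = cong₂ selR (openN-id ys x lx le) (openC-id ys P lP le)
openC-id ys (caseP x P Q) (lx , lP , lQ) le = cong₃ caseP (openN-id ys x lx le) (openC-id ys P lP le) (openC-id ys Q lQ le)
openC-id ys (whyP x P) (lx , lP) le = cong₂ whyP (openN-id ys x lx le) (openC-id ys P lP (s≤s le))
openC-id ys (bangP x P) (lx , lP) le = cong₂ bangP (openN-id ys x lx le) (openC-id ys P lP (s≤s le))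
openC-id ys (tsend x A P) (lx , lP) le = cong₂ (λ u v → tsend u A v) (openN-id ys x lx le) (openC-id ys P lP le)
openC-id ys (trecv x P) (lx , lP) le = cong₂ trecv (openN-id ys x lx le) (openC-id ys P lP le)
openC-id ys (asend x ls P) (lx , lP) le = cong₂ (λ u v → asend u ls v) (openN-id ys x lx le) (openC-id ys P lP (+-monoʳ-≤ (len ls) le))
openC-id ys (arecv x P) (lx , lP) le = cong₂ arecv (openN-id ys x lx le) (openC-id ys P lP le)
openC-id ys (run p ρ) lρ le = cong (run p) (openR-id ys ρ lρ le)
openC-id ys (closeP x) lx le = cong closeP (openN-id ys x lx le)
openC-id ys (waitP x P) (lx , lP) le = cong₂ waitP (openN-id ys x lx le) (openC-id ys P lP le)
openC-id ys (caseE x) lx le = cong caseE (openN-id ys x lx le)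
openC-id ys (link x A y) (lx , ly) le = cong₂ (λ u v → link u A v) (openN-id ys x lx le) (openN-id ys y ly le)
openC-id ys (nu A P Q) (lP , lQ) le = cong₂ (nu A) (openC-id ys P lP (s≤s le)) (openC-id ys Q lQ (s≤s le))
openC-id ys (lett ls P Q) (lP , lQ) le = cong₂ (lett ls) (openC-id ys P lP (+-monoʳ-≤ (len ls) le)) (openC-id ys Q lQ le)

lcR-openR⁻ : ∀ k zs ws ρ → lcR k (openR k (zs ++ ws) ρ)
           → Disjoint ws (fvR (openR k (zs ++ ws) ρ)) → lcR (k + len zs) ρ
lcR-openR⁻ k zs ws [] _ _ = tt
lcR-openR⁻ k zs ws ((l , x) ∷ ρ) (lx , lρ) d =
  lcN-openN⁻ k zs ws x lx (disjoint-++ˡ d) , lcR-openR⁻ k zs ws ρ lρ (disjoint-++ʳ d)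

-- An index opened to some w ∈ ws would make w occur,
-- so only the first len zs atoms can have closed indices.
lcC-openC⁻ : ∀ k zs ws P → lcC k (openC k (zs ++ ws) P)
           → Disjoint ws (fvC (openC k (zs ++ ws) P)) → lcC (k + len zs) P
lcC-openC⁻ k zs ws (out x P Q) (lx , lP , lQ) d =
  let dx , dP , dQ = disjoint-++⁻³ d in
  lcN-openN⁻ k zs ws x lx dx ,
  lcC-openC⁻ (suc k) zs ws P lP dP ,
  lcC-openC⁻ k zs ws Q lQ dQ
lcC-openC⁻ k zs ws (inp x P) (lx , lP) d =
  lcN-openN⁻ k zs ws x lx (disjoint-++ˡ d) , lcC-openC⁻ (suc k) zs ws P lP (disjoint-++ʳ d)
lcC-openC⁻ k zs ws (selL x P) (lx , lP) d =
  lcN-openN⁻ k zs ws x lx (disjoint-++ˡ d) , lcC-openC⁻ k zs ws P lP (disjoint-++ʳ d)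
lcC-openC⁻ k zs ws (selR x P) (lx , lP) d =
  lcN-openN⁻ k zs ws x lx (disjoint-++ˡ d) , lcC-openC⁻ k zs ws P lP (disjoint-++ʳ d)
lcC-openC⁻ k zs ws (caseP x P Q) (lx , lP , lQ) d =
  let dx , dP , dQ = disjoint-++⁻³ d in
  lcN-openN⁻ k zs ws x lx dx ,
  lcC-openC⁻ k zs ws P lP dP ,
  lcC-openC⁻ k zs ws Q lQ dQ
lcC-openC⁻ k zs ws (whyP x P) (lx , lP) d =
  lcN-openN⁻ k zs ws x lx (disjoint-++ˡ d) , lcC-openC⁻ (suc k) zs ws P lP (disjoint-++ʳ d)
lcC-openC⁻ k zs ws (bangP x P) (lx , lP) d =
  lcN-openN⁻ k zs ws x lx (disjoint-++ˡ d) , lcC-openC⁻ (suc k) zs ws P lP (disjoint-++ʳ d)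
lcC-openC⁻ k zs ws (tsend x A P) (lx , lP) d =
  lcN-openN⁻ k zs ws x lx (disjoint-++ˡ d) , lcC-openC⁻ k zs ws P lP (disjoint-++ʳ d)
lcC-openC⁻ k zs ws (trecv x P) (lx , lP) d =
  lcN-openN⁻ k zs ws x lx (disjoint-++ˡ d) , lcC-openC⁻ k zs ws P lP (disjoint-++ʳ d)
lcC-openC⁻ k zs ws (asend x ls P) (lx , lP) d =
  lcN-openN⁻ k zs ws x lx (disjoint-++ˡ d) ,
  subst (λ n → lcC n P) (+-assoc (len ls) k (len zs)) (lcC-openC⁻ (len ls + k) zs ws P lP (disjoint-++ʳ d))
lcC-openC⁻ k zs ws (arecv x P) (lx , lP) d =
  lcN-openN⁻ k zs ws x lx (disjoint-++ˡ d) , lcC-openC⁻ k zs ws P lP (disjoint-++ʳ d)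
lcC-openC⁻ k zs ws (run p ρ) lρ d = lcR-openR⁻ k zs ws ρ lρ d
lcC-openC⁻ k zs ws (closeP x) lx d = lcN-openN⁻ k zs ws x lx d
lcC-openC⁻ k zs ws (waitP x P) (lx , lP) d =
  lcN-openN⁻ k zs ws x lx (disjoint-++ˡ d) , lcC-openC⁻ k zs ws P lP (disjoint-++ʳ d)
lcC-openC⁻ k zs ws (caseE x) lx d = lcN-openN⁻ k zs ws x lx d
lcC-openC⁻ k zs ws (link x A y) (lx , ly) d =
  lcN-openN⁻ k zs ws x lx (disjoint-++ˡ d) , lcN-openN⁻ k zs ws y ly (disjoint-++ʳ d)
lcC-openC⁻ k zs ws (nu A P Q) (lP , lQ) d =
  lcC-openC⁻ (suc k) zs ws P lP (disjoint-++ˡ d) , lcC-openC⁻ (suc k) zs ws Q lQ (disjoint-++ʳ d)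
lcC-openC⁻ k zs ws (lett ls P Q) (lP , lQ) d =
  subst (λ n → lcC n P) (+-assoc (len ls) k (len zs)) (lcC-openC⁻ (len ls + k) zs ws P lP (disjoint-++ˡ d)) ,
  lcC-openC⁻ k zs ws Q lQ (disjoint-++ʳ d)

openR-closeR : ∀ k ys ρ → lcR k ρ → openR k ys (closeR k ys ρ) ≡ ρ
openR-closeR k ys [] _ = refl
openR-closeR k ys ((l , x) ∷ ρ) (lx , lρ) = cong₂ (λ u v → (l , u) ∷ v) (openN-closeN k ys x lx) (openR-closeR k ys ρ lρ)

openC-closeC : ∀ k ys P → lcC k P → openC k ys (closeC k ys P) ≡ P
openC-closeC k ys (out x P Q) (lx , lP , lQ) = cong₃ out (openN-closeN k ys x lx) (openC-closeC (suc k) ys P lP) (openC-closeC k ys Q lQ)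
openC-closeC k ys (inp x P) (lx , lP) = cong₂ inp (openN-closeN k ys x lx) (openC-closeC (suc k) ys P lP)
openC-closeC k ys (selL x P) (lx , lP) = cong₂ selL (openN-closeN k ys x lx) (openC-closeC k ys P lP)
openC-closeC k ys (selR x P) (lx , lP) = cong₂ selR (openN-closeN k ys x lx) (openC-closeC k ys P lP)
openC-closeC k ys (caseP x P Q) (lx , lP , lQ) = cong₃ caseP (openN-closeN k ys x lx) (openC-closeC k ys P lP) (openC-closeC k ys Q lQ)
openC-closeC k ys (whyP x P) (lx , lP) = cong₂ whyP (openN-closeN k ys x lx) (openC-closeC (suc k) ys P lP)
openC-closeC k ys (bangP x P) (lx , lP) = cong₂ bangP (openN-closeN k ys x lx) (openC-closeC (suc k) ys P lP)
openC-closeC k ys (tsend x A P) (lx , lP) = cong₂ (λ u v → tsend u A v) (openN-closeN k ys x lx) (openC-closeC k ys P lP)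
openC-closeC k ys (trecv x P) (lx , lP) = cong₂ trecv (openN-closeN k ys x lx) (openC-closeC k ys P lP)
openC-closeC k ys (asend x ls P) (lx , lP) = cong₂ (λ u v → asend u ls v) (openN-closeN k ys x lx) (openC-closeC (len ls + k) ys P lP)
openC-closeC k ys (arecv x P) (lx , lP) = cong₂ arecv (openN-closeN k ys x lx) (openC-closeC k ys P lP)
openC-closeC k ys (run p ρ) lρ = cong (run p) (openR-closeR k ys ρ lρ)
openC-closeC k ys (closeP x) lx = cong closeP (openN-closeN k ys x lx)
openC-closeC k ys (waitP x P) (lx , lP) = cong₂ waitP (openN-closeN k ys x lx) (openC-closeC k ys P lP)
openC-closeC k ys (caseE x) lx = cong caseE (openN-closeN k ys x lx)
openC-closeC k ys (link x A y) (lx , ly) = cong₂ (λ u v → link u A v) (openN-closeN k ys x lx) (openN-closeN k ys y ly)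
openC-closeC k ys (nu A P Q) (lP , lQ) = cong₂ (nu A) (openC-closeC (suc k) ys P lP) (openC-closeC (suc k) ys Q lQ)
openC-closeC k ys (lett ls P Q) (lP , lQ) = cong₂ (lett ls) (openC-closeC (len ls + k) ys P lP) (openC-closeC k ys Q lQ)

closeR-lcR : ∀ k ys ρ → lcR k ρ → lcR (k + len ys) (closeR k ys ρ)
closeR-lcR k ys [] _ = tt
closeR-lcR k ys ((l , x) ∷ ρ) (lx , lρ) = closeN-lcN k ys x lx , closeR-lcR k ys ρ lρ

closeC-lcC : ∀ k ys P → lcC k P → lcC (k + len ys) (closeC k ys P)
closeC-lcC k ys (out x P Q) (lx , lP , lQ) = closeN-lcN k ys x lx , closeC-lcC (suc k) ys P lP , closeC-lcC k ys Q lQ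
closeC-lcC k ys (inp x P) (lx , lP) = closeN-lcN k ys x lx , closeC-lcC (suc k) ys P lP
closeC-lcC k ys (selL x P) (lx , lP) = closeN-lcN k ys x lx , closeC-lcC k ys P lP
closeC-lcC k ys (selR x P) (lx , lP) = closeN-lcN k ys x lx , closeC-lcC k ys P lP
closeC-lcC k ys (caseP x P Q) (lx , lP , lQ) = closeN-lcN k ys x lx , closeC-lcC k ys P lP , closeC-lcC k ys Q lQ
closeC-lcC k ys (whyP x P) (lx , lP) = closeN-lcN k ys x lx , closeC-lcC (suc k) ys P lP
closeC-lcC k ys (bangP x P) (lx , lP) = closeN-lcN k ys x lx , closeC-lcC (suc k) ys P lP
closeC-lcC k ys (tsend x A P) (lx , lP) = closeN-lcN k ys x lx , closeC-lcC k ys P lP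
closeC-lcC k ys (trecv x P) (lx , lP) = closeN-lcN k ys x lx , closeC-lcC k ys P lP
closeC-lcC k ys (asend x ls P) (lx , lP) = closeN-lcN k ys x lx ,
  subst (λ n → lcC n (closeC (len ls + k) ys P)) (+-assoc (len ls) k (len ys)) (closeC-lcC (len ls + k) ys P lP)
closeC-lcC k ys (arecv x P) (lx , lP) = closeN-lcN k ys x lx , closeC-lcC k ys P lP
closeC-lcC k ys (run p ρ) lρ = closeR-lcR k ys ρ lρ
closeC-lcC k ys (closeP x) lx = closeN-lcN k ys x lx
closeC-lcC k ys (waitP x P) (lx , lP) = closeN-lcN k ys x lx , closeC-lcC k ys P lP
closeC-lcC k ys (caseE x) lx = closeN-lcN k ys x lx
closeC-lcC k ys (link x A y) (lx , ly) = closeN-lcN k ys x lx , closeN-lcN k ys y ly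
closeC-lcC k ys (nu A P Q) (lP , lQ) = closeC-lcC (suc k) ys P lP , closeC-lcC (suc k) ys Q lQ
closeC-lcC k ys (lett ls P Q) (lP , lQ) =
  subst (λ n → lcC n (closeC (len ls + k) ys P)) (+-assoc (len ls) k (len ys)) (closeC-lcC (len ls + k) ys P lP) , closeC-lcC k ys Q lQ

closeR-fresh : ∀ k ys ρ → Disjoint ys (fvR (closeR k ys ρ))
closeR-fresh k ys [] (_ , ())
closeR-fresh k ys ((l , x) ∷ ρ) = disjoint-++⁺ (closeN-fresh k ys x) (closeR-fresh k ys ρ)

closeC-fresh : ∀ k ys P → Disjoint ys (fvC (closeC k ys P))
closeC-fresh k ys (out x P Q) = disjoint-++⁺ (closeN-fresh k ys x) (disjoint-++⁺ (closeC-fresh (suc k) ys P) (closeC-fresh k ys Q))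
closeC-fresh k ys (inp x P) = disjoint-++⁺ (closeN-fresh k ys x) (closeC-fresh (suc k) ys P)
closeC-fresh k ys (selL x P) = disjoint-++⁺ (closeN-fresh k ys x) (closeC-fresh k ys P)
closeC-fresh k ys (selR x P) = disjoint-++⁺ (closeN-fresh k ys x) (closeC-fresh k ys P)
closeC-fresh k ys (caseP x P Q) = disjoint-++⁺ (closeN-fresh k ys x) (disjoint-++⁺ (closeC-fresh k ys P) (closeC-fresh k ys Q))
closeC-fresh k ys (whyP x P) = disjoint-++⁺ (closeN-fresh k ys x) (closeC-fresh (suc k) ys P)
closeC-fresh k ys (bangP x P) = disjoint-++⁺ (closeN-fresh k ys x) (closeC-fresh (suc k) ys P)
closeC-fresh k ys (tsend x A P) = disjoint-++⁺ (closeN-fresh k ys x) (closeC-fresh k ys P)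
closeC-fresh k ys (trecv x P) = disjoint-++⁺ (closeN-fresh k ys x) (closeC-fresh k ys P)
closeC-fresh k ys (asend x ls P) = disjoint-++⁺ (closeN-fresh k ys x) (closeC-fresh (len ls + k) ys P)
closeC-fresh k ys (arecv x P) = disjoint-++⁺ (closeN-fresh k ys x) (closeC-fresh k ys P)
closeC-fresh k ys (run p ρ) = closeR-fresh k ys ρ
closeC-fresh k ys (closeP x) = closeN-fresh k ys x
closeC-fresh k ys (waitP x P) = disjoint-++⁺ (closeN-fresh k ys x) (closeC-fresh k ys P)
closeC-fresh k ys (caseE x) = closeN-fresh k ys x
closeC-fresh k ys (link x A y) = disjoint-++⁺ (closeN-fresh k ys x) (closeN-fresh k ys y)
closeC-fresh k ys (nu A P Q) = disjoint-++⁺ (closeC-fresh (suc k) ys P) (closeC-fresh (suc k) ys Q)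
closeC-fresh k ys (lett ls P Q) = disjoint-++⁺ (closeC-fresh (len ls + k) ys P) (closeC-fresh k ys Q)

lcN-renN : ∀ n x y z → lcN n (renN x y z) ≡ lcN n z
lcN-renN n x y (fv a) with a ≡ᵇ y
... | true = refl
... | false = refl
lcN-renN n x y (bv j) = refl

lcR-renR : ∀ n x y ρ → lcR n (renR x y ρ) ≡ lcR n ρ
lcR-renR n x y [] = refl
lcR-renR n x y ((l , z) ∷ ρ) = cong₂ _×_ (lcN-renN n x y z) (lcR-renR n x y ρ)

lcC-renC : ∀ n x y P → lcC n (renC x y P) ≡ lcC n P
lcC-renC n x y (out z P Q) = cong₂ _×_ (lcN-renN n x y z) (cong₂ _×_ (lcC-renC (suc n) x y P) (lcC-renC n x y Q))
lcC-renC n x y (inp z P) = cong₂ _×_ (lcN-renN n x y z) (lcC-renC (suc n) x y P)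
lcC-renC n x y (selL z P) = cong₂ _×_ (lcN-renN n x y z) (lcC-renC n x y P)
lcC-renC n x y (selR z P) = cong₂ _×_ (lcN-renN n x y z) (lcC-renC n x y P)
lcC-renC n x y (caseP z P Q) = cong₂ _×_ (lcN-renN n x y z) (cong₂ _×_ (lcC-renC n x y P) (lcC-renC n x y Q))
lcC-renC n x y (whyP z P) = cong₂ _×_ (lcN-renN n x y z) (lcC-renC (suc n) x y P)
lcC-renC n x y (bangP z P) = cong₂ _×_ (lcN-renN n x y z) (lcC-renC (suc n) x y P)
lcC-renC n x y (tsend z A P) = cong₂ _×_ (lcN-renN n x y z) (lcC-renC n x y P)
lcC-renC n x y (trecv z P) = cong₂ _×_ (lcN-renN n x y z) (lcC-renC n x y P)
lcC-renC n x y (asend z ls P) = cong₂ _×_ (lcN-renN n x y z) (lcC-renC (len ls + n) x y P)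
lcC-renC n x y (arecv z P) = cong₂ _×_ (lcN-renN n x y z) (lcC-renC n x y P)
lcC-renC n x y (run p ρ) = lcR-renR n x y ρ
lcC-renC n x y (closeP z) = lcN-renN n x y z
lcC-renC n x y (waitP z P) = cong₂ _×_ (lcN-renN n x y z) (lcC-renC n x y P)
lcC-renC n x y (caseE z) = lcN-renN n x y z
lcC-renC n x y (link z A w) = cong₂ _×_ (lcN-renN n x y z) (lcN-renN n x y w)
lcC-renC n x y (nu A P Q) = cong₂ _×_ (lcC-renC (suc n) x y P) (lcC-renC (suc n) x y Q)
lcC-renC n x y (lett ls P Q) = cong₂ _×_ (lcC-renC (len ls + n) x y P) (lcC-renC n x y Q)

lcC-openTP : ∀ n k A P → lcC n (openTP k A P) ≡ lcC n P
lcC-openTP n k B (out z P Q) = cong₂ _×_ refl (cong₂ _×_ (lcC-openTP (suc n) k B P) (lcC-openTP n k B Q))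
lcC-openTP n k B (inp z P) = cong₂ _×_ refl (lcC-openTP (suc n) k B P)
lcC-openTP n k B (selL z P) = cong₂ _×_ refl (lcC-openTP n k B P)
lcC-openTP n k B (selR z P) = cong₂ _×_ refl (lcC-openTP n k B P)
lcC-openTP n k B (caseP z P Q) = cong₂ _×_ refl (cong₂ _×_ (lcC-openTP n k B P) (lcC-openTP n k B Q))
lcC-openTP n k B (whyP z P) = cong₂ _×_ refl (lcC-openTP (suc n) k B P)
lcC-openTP n k B (bangP z P) = cong₂ _×_ refl (lcC-openTP (suc n) k B P)
lcC-openTP n k B (tsend z A P) = cong₂ _×_ refl (lcC-openTP n k B P)
lcC-openTP n k B (trecv z P) = cong₂ _×_ refl (lcC-openTP n (suc k) B P)
lcC-openTP n k B (asend z ls P) = cong₂ _×_ refl (lcC-openTP (len ls + n) k B P)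
lcC-openTP n k B (arecv z P) = cong₂ _×_ refl (lcC-openTP n k B P)
lcC-openTP n k B (run p ρ) = refl
lcC-openTP n k B (closeP z) = refl
lcC-openTP n k B (waitP z P) = cong₂ _×_ refl (lcC-openTP n k B P)
lcC-openTP n k B (caseE z) = refl
lcC-openTP n k B (link z A w) = refl
lcC-openTP n k B (nu A P Q) = cong₂ _×_ (lcC-openTP (suc n) k B P) (lcC-openTP (suc n) k B Q)
lcC-openTP n k B (lett ls P Q) = cong₂ _×_ (lcC-openTP (len ls + n) k B P) (lcC-openTP n k B Q)

lcC-openPV : ∀ n k p P → lcC n (openPV k p P) ≡ lcC n P
lcC-openPV n k q (out z P Q) = cong₂ _×_ refl (cong₂ _×_ (lcC-openPV (suc n) k q P) (lcC-openPV n k q Q))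
lcC-openPV n k q (inp z P) = cong₂ _×_ refl (lcC-openPV (suc n) k q P)
lcC-openPV n k q (selL z P) = cong₂ _×_ refl (lcC-openPV n k q P)
lcC-openPV n k q (selR z P) = cong₂ _×_ refl (lcC-openPV n k q P)
lcC-openPV n k q (caseP z P Q) = cong₂ _×_ refl (cong₂ _×_ (lcC-openPV n k q P) (lcC-openPV n k q Q))
lcC-openPV n k q (whyP z P) = cong₂ _×_ refl (lcC-openPV (suc n) k q P)
lcC-openPV n k q (bangP z P) = cong₂ _×_ refl (lcC-openPV (suc n) k q P)
lcC-openPV n k q (tsend z A P) = cong₂ _×_ refl (lcC-openPV n k q P)
lcC-openPV n k q (trecv z P) = cong₂ _×_ refl (lcC-openPV n k q P)
lcC-openPV n k q (asend z ls P) = cong₂ _×_ refl (lcC-openPV (len ls + n) k q P)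
lcC-openPV n k q (arecv z P) = cong₂ _×_ refl (lcC-openPV n (suc k) q P)
lcC-openPV n k q (run p ρ) = refl
lcC-openPV n k q (closeP z) = refl
lcC-openPV n k q (waitP z P) = cong₂ _×_ refl (lcC-openPV n k q P)
lcC-openPV n k q (caseE z) = refl
lcC-openPV n k q (link z A w) = refl
lcC-openPV n k q (nu A P Q) = cong₂ _×_ (lcC-openPV (suc n) k q P) (lcC-openPV (suc n) k q Q)
lcC-openPV n k q (lett ls P Q) = cong₂ _×_ (lcC-openPV (len ls + n) k q P) (lcC-openPV n (suc k) q Q)

lcC-closePV : ∀ n k p P → lcC n (closePV k p P) ≡ lcC n P
lcC-closePV n k q (out z P Q) = cong₂ _×_ refl (cong₂ _×_ (lcC-closePV (suc n) k q P) (lcC-closePV n k q Q))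
lcC-closePV n k q (inp z P) = cong₂ _×_ refl (lcC-closePV (suc n) k q P)
lcC-closePV n k q (selL z P) = cong₂ _×_ refl (lcC-closePV n k q P)
lcC-closePV n k q (selR z P) = cong₂ _×_ refl (lcC-closePV n k q P)
lcC-closePV n k q (caseP z P Q) = cong₂ _×_ refl (cong₂ _×_ (lcC-closePV n k q P) (lcC-closePV n k q Q))
lcC-closePV n k q (whyP z P) = cong₂ _×_ refl (lcC-closePV (suc n) k q P)
lcC-closePV n k q (bangP z P) = cong₂ _×_ refl (lcC-closePV (suc n) k q P)
lcC-closePV n k q (tsend z A P) = cong₂ _×_ refl (lcC-closePV n k q P)
lcC-closePV n k q (trecv z P) = cong₂ _×_ refl (lcC-closePV n k q P)
lcC-closePV n k q (asend z ls P) = cong₂ _×_ refl (lcC-closePV (len ls + n) k q P)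
lcC-closePV n k q (arecv z P) = cong₂ _×_ refl (lcC-closePV n (suc k) q P)
lcC-closePV n k q (run p ρ) = refl
lcC-closePV n k q (closeP z) = refl
lcC-closePV n k q (waitP z P) = cong₂ _×_ refl (lcC-closePV n k q P)
lcC-closePV n k q (caseE z) = refl
lcC-closePV n k q (link z A w) = refl
lcC-closePV n k q (nu A P Q) = cong₂ _×_ (lcC-closePV (suc n) k q P) (lcC-closePV (suc n) k q Q)
lcC-closePV n k q (lett ls P Q) = cong₂ _×_ (lcC-closePV (len ls + n) k q P) (lcC-closePV n (suc k) q Q)

lcPV-openPV⁻ : ∀ n p P → lcPV n (openPV n p P) → lcPV (suc n) P
lcPV-openPV⁻ n p (out x P Q) (lP , lQ) = lcPV-openPV⁻ n p P lP , lcPV-openPV⁻ n p Q lQ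
lcPV-openPV⁻ n p (inp x P) lP = lcPV-openPV⁻ n p P lP
lcPV-openPV⁻ n p (selL x P) lP = lcPV-openPV⁻ n p P lP
lcPV-openPV⁻ n p (selR x P) lP = lcPV-openPV⁻ n p P lP
lcPV-openPV⁻ n p (caseP x P Q) (lP , lQ) = lcPV-openPV⁻ n p P lP , lcPV-openPV⁻ n p Q lQ
lcPV-openPV⁻ n p (whyP x P) lP = lcPV-openPV⁻ n p P lP
lcPV-openPV⁻ n p (bangP x P) lP = lcPV-openPV⁻ n p P lP
lcPV-openPV⁻ n p (tsend x A P) lP = lcPV-openPV⁻ n p P lP
lcPV-openPV⁻ n p (trecv x P) lP = lcPV-openPV⁻ n p P lP
lcPV-openPV⁻ n p (asend x ls P) lP = lcPV-openPV⁻ n p P lP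
lcPV-openPV⁻ n p (arecv x P) lP = lcPV-openPV⁻ (suc n) p P lP
lcPV-openPV⁻ n p (run q ρ) lq = lcN-openPN⁻ n p q lq
lcPV-openPV⁻ n p (closeP x) lP = tt
lcPV-openPV⁻ n p (waitP x P) lP = lcPV-openPV⁻ n p P lP
lcPV-openPV⁻ n p (caseE x) lP = tt
lcPV-openPV⁻ n p (link x A y) lP = tt
lcPV-openPV⁻ n p (nu A P Q) (lP , lQ) = lcPV-openPV⁻ n p P lP , lcPV-openPV⁻ n p Q lQ
lcPV-openPV⁻ n p (lett ls P Q) (lP , lQ) = lcPV-openPV⁻ n p P lP , lcPV-openPV⁻ (suc n) p Q lQ

openPV-closePV : ∀ k p Q → lcPV k Q → openPV k p (closePV k p Q) ≡ Q
openPV-closePV k p (out x P Q) (lP , lQ) = cong₂ (out x) (openPV-closePV k p P lP) (openPV-closePV k p Q lQ)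
openPV-closePV k p (inp x P) lP = cong (inp x) (openPV-closePV k p P lP)
openPV-closePV k p (selL x P) lP = cong (selL x) (openPV-closePV k p P lP)
openPV-closePV k p (selR x P) lP = cong (selR x) (openPV-closePV k p P lP)
openPV-closePV k p (caseP x P Q) (lP , lQ) = cong₂ (caseP x) (openPV-closePV k p P lP) (openPV-closePV k p Q lQ)
openPV-closePV k p (whyP x P) lP = cong (whyP x) (openPV-closePV k p P lP)
openPV-closePV k p (bangP x P) lP = cong (bangP x) (openPV-closePV k p P lP)
openPV-closePV k p (tsend x A P) lP = cong (tsend x A) (openPV-closePV k p P lP)
openPV-closePV k p (trecv x P) lP = cong (trecv x) (openPV-closePV k p P lP)
openPV-closePV k p (asend x ls P) lP = cong (asend x ls) (openPV-closePV k p P lP)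
openPV-closePV k p (arecv x P) lP = cong (arecv x) (openPV-closePV (suc k) p P lP)
openPV-closePV k p (run q ρ) lq = cong (λ u → run u ρ) (openPN-closePN k p q lq)
openPV-closePV k p (closeP x) lP = refl
openPV-closePV k p (waitP x P) lP = cong (waitP x) (openPV-closePV k p P lP)
openPV-closePV k p (caseE x) lP = refl
openPV-closePV k p (link x A y) lP = refl
openPV-closePV k p (nu A P Q) (lP , lQ) = cong₂ (nu A) (openPV-closePV k p P lP) (openPV-closePV k p Q lQ)
openPV-closePV k p (lett ls P Q) (lP , lQ) = cong₂ (lett ls) (openPV-closePV k p P lP) (openPV-closePV (suc k) p Q lQ)

closePV-fresh : ∀ k p Q → p ∉ fpv (closePV k p Q)
closePV-fresh k p (out x P Q) = ∉-++⁺ (closePV-fresh k p P) (closePV-fresh k p Q)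
closePV-fresh k p (inp x P) = closePV-fresh k p P
closePV-fresh k p (selL x P) = closePV-fresh k p P
closePV-fresh k p (selR x P) = closePV-fresh k p P
closePV-fresh k p (caseP x P Q) = ∉-++⁺ (closePV-fresh k p P) (closePV-fresh k p Q)
closePV-fresh k p (whyP x P) = closePV-fresh k p P
closePV-fresh k p (bangP x P) = closePV-fresh k p P
closePV-fresh k p (tsend x A P) = closePV-fresh k p P
closePV-fresh k p (trecv x P) = closePV-fresh k p P
closePV-fresh k p (asend x ls P) = closePV-fresh k p P
closePV-fresh k p (arecv x P) = closePV-fresh (suc k) p P
closePV-fresh k p (run q ρ) = closePN-fresh k p q
closePV-fresh k p (closeP x) ()
closePV-fresh k p (waitP x P) = closePV-fresh k p P
closePV-fresh k p (caseE x) ()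
closePV-fresh k p (link x A y) ()
closePV-fresh k p (nu A P Q) = ∉-++⁺ (closePV-fresh k p P) (closePV-fresh k p Q)
closePV-fresh k p (lett ls P Q) = ∉-++⁺ (closePV-fresh k p P) (closePV-fresh (suc k) p Q)

lcPV-openC : ∀ n k ys P → lcPV n (openC k ys P) ≡ lcPV n P
lcPV-openC n k ys (out x P Q) = cong₂ _×_ (lcPV-openC n (suc k) ys P) (lcPV-openC n k ys Q)
lcPV-openC n k ys (inp x P) = lcPV-openC n (suc k) ys P
lcPV-openC n k ys (selL x P) = lcPV-openC n k ys P
lcPV-openC n k ys (selR x P) = lcPV-openC n k ys P
lcPV-openC n k ys (caseP x P Q) = cong₂ _×_ (lcPV-openC n k ys P) (lcPV-openC n k ys Q)
lcPV-openC n k ys (whyP x P) = lcPV-openC n (suc k) ys P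
lcPV-openC n k ys (bangP x P) = lcPV-openC n (suc k) ys P
lcPV-openC n k ys (tsend x A P) = lcPV-openC n k ys P
lcPV-openC n k ys (trecv x P) = lcPV-openC n k ys P
lcPV-openC n k ys (asend x ls P) = lcPV-openC n (len ls + k) ys P
lcPV-openC n k ys (arecv x P) = lcPV-openC (suc n) k ys P
lcPV-openC n k ys (run p ρ) = refl
lcPV-openC n k ys (closeP x) = refl
lcPV-openC n k ys (waitP x P) = lcPV-openC n k ys P
lcPV-openC n k ys (caseE x) = refl
lcPV-openC n k ys (link x A y) = refl
lcPV-openC n k ys (nu A P Q) = cong₂ _×_ (lcPV-openC n (suc k) ys P) (lcPV-openC n (suc k) ys Q)
lcPV-openC n k ys (lett ls P Q) = cong₂ _×_ (lcPV-openC n (len ls + k) ys P) (lcPV-openC (suc n) k ys Q)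

lcPV-openTP : ∀ n k B P → lcPV n (openTP k B P) ≡ lcPV n P
lcPV-openTP n k B (out x P Q) = cong₂ _×_ (lcPV-openTP n k B P) (lcPV-openTP n k B Q)
lcPV-openTP n k B (inp x P) = lcPV-openTP n k B P
lcPV-openTP n k B (selL x P) = lcPV-openTP n k B P
lcPV-openTP n k B (selR x P) = lcPV-openTP n k B P
lcPV-openTP n k B (caseP x P Q) = cong₂ _×_ (lcPV-openTP n k B P) (lcPV-openTP n k B Q)
lcPV-openTP n k B (whyP x P) = lcPV-openTP n k B P
lcPV-openTP n k B (bangP x P) = lcPV-openTP n k B P
lcPV-openTP n k B (tsend x A P) = lcPV-openTP n k B P
lcPV-openTP n k B (trecv x P) = lcPV-openTP n (suc k) B P
lcPV-openTP n k B (asend x ls P) = lcPV-openTP n k B P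
lcPV-openTP n k B (arecv x P) = lcPV-openTP (suc n) k B P
lcPV-openTP n k B (run p ρ) = refl
lcPV-openTP n k B (closeP x) = refl
lcPV-openTP n k B (waitP x P) = lcPV-openTP n k B P
lcPV-openTP n k B (caseE x) = refl
lcPV-openTP n k B (link x A y) = refl
lcPV-openTP n k B (nu A P Q) = cong₂ _×_ (lcPV-openTP n k B P) (lcPV-openTP n k B Q)
lcPV-openTP n k B (lett ls P Q) = cong₂ _×_ (lcPV-openTP n k B P) (lcPV-openTP (suc n) k B Q)

lcPV-renC : ∀ n x y P → lcPV n (renC x y P) ≡ lcPV n P
lcPV-renC n a b (out x P Q) = cong₂ _×_ (lcPV-renC n a b P) (lcPV-renC n a b Q)
lcPV-renC n a b (inp x P) = lcPV-renC n a b P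
lcPV-renC n a b (selL x P) = lcPV-renC n a b P
lcPV-renC n a b (selR x P) = lcPV-renC n a b P
lcPV-renC n a b (caseP x P Q) = cong₂ _×_ (lcPV-renC n a b P) (lcPV-renC n a b Q)
lcPV-renC n a b (whyP x P) = lcPV-renC n a b P
lcPV-renC n a b (bangP x P) = lcPV-renC n a b P
lcPV-renC n a b (tsend x A P) = lcPV-renC n a b P
lcPV-renC n a b (trecv x P) = lcPV-renC n a b P
lcPV-renC n a b (asend x ls P) = lcPV-renC n a b P
lcPV-renC n a b (arecv x P) = lcPV-renC (suc n) a b P
lcPV-renC n a b (run p ρ) = refl
lcPV-renC n a b (closeP x) = refl
lcPV-renC n a b (waitP x P) = lcPV-renC n a b P
lcPV-renC n a b (caseE x) = refl
lcPV-renC n a b (link x A y) = refl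
lcPV-renC n a b (nu A P Q) = cong₂ _×_ (lcPV-renC n a b P) (lcPV-renC n a b Q)
lcPV-renC n a b (lett ls P Q) = cong₂ _×_ (lcPV-renC n a b P) (lcPV-renC (suc n) a b Q)

-- Free channel names of processes

fvN-openN : ∀ k ys x → fvN x ⊆ fvN (openN k ys x)
fvN-openN k ys (fv a) m = m
fvN-openN k ys (bv j) ()

fvR-openR : ∀ k ys ρ → fvR ρ ⊆ fvR (openR k ys ρ)
fvR-openR k ys [] ()
fvR-openR k ys ((l , x) ∷ ρ) = ++⁺ (fvN-openN k ys x) (fvR-openR k ys ρ)

fvC-openC : ∀ k ys P → fvC P ⊆ fvC (openC k ys P)
fvC-openC k ys (out x P Q) = ++⁺ (fvN-openN k ys x) (++⁺ (fvC-openC (suc k) ys P) (fvC-openC k ys Q))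
fvC-openC k ys (inp x P) = ++⁺ (fvN-openN k ys x) (fvC-openC (suc k) ys P)
fvC-openC k ys (selL x P) = ++⁺ (fvN-openN k ys x) (fvC-openC k ys P)
fvC-openC k ys (selR x P) = ++⁺ (fvN-openN k ys x) (fvC-openC k ys P)
fvC-openC k ys (caseP x P Q) = ++⁺ (fvN-openN k ys x) (++⁺ (fvC-openC k ys P) (fvC-openC k ys Q))
fvC-openC k ys (whyP x P) = ++⁺ (fvN-openN k ys x) (fvC-openC (suc k) ys P)
fvC-openC k ys (bangP x P) = ++⁺ (fvN-openN k ys x) (fvC-openC (suc k) ys P)
fvC-openC k ys (tsend x A P) = ++⁺ (fvN-openN k ys x) (fvC-openC k ys P)
fvC-openC k ys (trecv x P) = ++⁺ (fvN-openN k ys x) (fvC-openC k ys P)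
fvC-openC k ys (asend x ls P) = ++⁺ (fvN-openN k ys x) (fvC-openC (len ls + k) ys P)
fvC-openC k ys (arecv x P) = ++⁺ (fvN-openN k ys x) (fvC-openC k ys P)
fvC-openC k ys (run p ρ) = fvR-openR k ys ρ
fvC-openC k ys (closeP x) = fvN-openN k ys x
fvC-openC k ys (waitP x P) = ++⁺ (fvN-openN k ys x) (fvC-openC k ys P)
fvC-openC k ys (caseE x) = fvN-openN k ys x
fvC-openC k ys (link x A y) = ++⁺ (fvN-openN k ys x) (fvN-openN k ys y)
fvC-openC k ys (nu A P Q) = ++⁺ (fvC-openC (suc k) ys P) (fvC-openC (suc k) ys Q)
fvC-openC k ys (lett ls P Q) = ++⁺ (fvC-openC (len ls + k) ys P) (fvC-openC k ys Q)

fvC-openTP : ∀ k B P → fvC (openTP k B P) ≡ fvC P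
fvC-openTP k B (out x P Q) = cong₂ (λ u v → fvN x ++ u ++ v) (fvC-openTP k B P) (fvC-openTP k B Q)
fvC-openTP k B (inp x P) = cong (fvN x ++_) (fvC-openTP k B P)
fvC-openTP k B (selL x P) = cong (fvN x ++_) (fvC-openTP k B P)
fvC-openTP k B (selR x P) = cong (fvN x ++_) (fvC-openTP k B P)
fvC-openTP k B (caseP x P Q) = cong₂ (λ u v → fvN x ++ u ++ v) (fvC-openTP k B P) (fvC-openTP k B Q)
fvC-openTP k B (whyP x P) = cong (fvN x ++_) (fvC-openTP k B P)
fvC-openTP k B (bangP x P) = cong (fvN x ++_) (fvC-openTP k B P)
fvC-openTP k B (tsend x A P) = cong (fvN x ++_) (fvC-openTP k B P)
fvC-openTP k B (trecv x P) = cong (fvN x ++_) (fvC-openTP (suc k) B P)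
fvC-openTP k B (asend x ls P) = cong (fvN x ++_) (fvC-openTP k B P)
fvC-openTP k B (arecv x P) = cong (fvN x ++_) (fvC-openTP k B P)
fvC-openTP k B (run p ρ) = refl
fvC-openTP k B (closeP x) = refl
fvC-openTP k B (waitP x P) = cong (fvN x ++_) (fvC-openTP k B P)
fvC-openTP k B (caseE x) = refl
fvC-openTP k B (link x A y) = refl
fvC-openTP k B (nu A P Q) = cong₂ _++_ (fvC-openTP k B P) (fvC-openTP k B Q)
fvC-openTP k B (lett ls P Q) = cong₂ _++_ (fvC-openTP k B P) (fvC-openTP k B Q)

fvC-openPV : ∀ k p P → fvC (openPV k p P) ≡ fvC P
fvC-openPV k p (out x P Q) = cong₂ (λ u v → fvN x ++ u ++ v) (fvC-openPV k p P) (fvC-openPV k p Q)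
fvC-openPV k p (inp x P) = cong (fvN x ++_) (fvC-openPV k p P)
fvC-openPV k p (selL x P) = cong (fvN x ++_) (fvC-openPV k p P)
fvC-openPV k p (selR x P) = cong (fvN x ++_) (fvC-openPV k p P)
fvC-openPV k p (caseP x P Q) = cong₂ (λ u v → fvN x ++ u ++ v) (fvC-openPV k p P) (fvC-openPV k p Q)
fvC-openPV k p (whyP x P) = cong (fvN x ++_) (fvC-openPV k p P)
fvC-openPV k p (bangP x P) = cong (fvN x ++_) (fvC-openPV k p P)
fvC-openPV k p (tsend x A P) = cong (fvN x ++_) (fvC-openPV k p P)
fvC-openPV k p (trecv x P) = cong (fvN x ++_) (fvC-openPV k p P)
fvC-openPV k p (asend x ls P) = cong (fvN x ++_) (fvC-openPV k p P)
fvC-openPV k p (arecv x P) = cong (fvN x ++_) (fvC-openPV (suc k) p P)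
fvC-openPV k p (run q ρ) = refl
fvC-openPV k p (closeP x) = refl
fvC-openPV k p (waitP x P) = cong (fvN x ++_) (fvC-openPV k p P)
fvC-openPV k p (caseE x) = refl
fvC-openPV k p (link x A y) = refl
fvC-openPV k p (nu A P Q) = cong₂ _++_ (fvC-openPV k p P) (fvC-openPV k p Q)
fvC-openPV k p (lett ls P Q) = cong₂ _++_ (fvC-openPV k p P) (fvC-openPV (suc k) p Q)

Renames : Atom → Atom → List Atom → List Atom → Set
Renames x y L L' = ∀ {a} → a ∈ L → a ≡ x ⊎ (a ≢ y × a ∈ L')

renames-++ : ∀ {x y L₁ L₁' L₂ L₂'} → Renames x y L₁ L₁' → Renames x y L₂ L₂'
           → Renames x y (L₁ ++ L₂) (L₁' ++ L₂')
renames-++ {L₁ = L₁} {L₁'} r₁ r₂ a∈ with ∈-++⁻ L₁ a∈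
... | inj₁ a∈₁ = Sum.map₂ (Product.map₂ ∈-++⁺ˡ) (r₁ a∈₁)
... | inj₂ a∈₂ = Sum.map₂ (Product.map₂ (∈-++⁺ʳ L₁')) (r₂ a∈₂)

fvN-renN : ∀ x y z → Renames x y (fvN (renN x y z)) (fvN z)
fvN-renN x y (fv a) a∈ with a ≡ᵇ y | ≡ᵇ-reflects-≡ a y
fvN-renN x y (fv a) (here refl) | true | _ = inj₁ refl
fvN-renN x y (fv a) (here refl) | false | ofⁿ a≢y = inj₂ (a≢y , here refl)
fvN-renN x y (bv j) ()

fvR-renR : ∀ x y ρ → Renames x y (fvR (renR x y ρ)) (fvR ρ)
fvR-renR x y [] ()
fvR-renR x y ((l , z) ∷ ρ) = renames-++ (fvN-renN x y z) (fvR-renR x y ρ)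

fvC-renC : ∀ x y P → Renames x y (fvC (renC x y P)) (fvC P)
fvC-renC x y (out z P Q) = renames-++ (fvN-renN x y z) (renames-++ (fvC-renC x y P) (fvC-renC x y Q))
fvC-renC x y (inp z P) = renames-++ (fvN-renN x y z) (fvC-renC x y P)
fvC-renC x y (selL z P) = renames-++ (fvN-renN x y z) (fvC-renC x y P)
fvC-renC x y (selR z P) = renames-++ (fvN-renN x y z) (fvC-renC x y P)
fvC-renC x y (caseP z P Q) = renames-++ (fvN-renN x y z) (renames-++ (fvC-renC x y P) (fvC-renC x y Q))
fvC-renC x y (whyP z P) = renames-++ (fvN-renN x y z) (fvC-renC x y P)
fvC-renC x y (bangP z P) = renames-++ (fvN-renN x y z) (fvC-renC x y P)
fvC-renC x y (tsend z A P) = renames-++ (fvN-renN x y z) (fvC-renC x y P)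
fvC-renC x y (trecv z P) = renames-++ (fvN-renN x y z) (fvC-renC x y P)
fvC-renC x y (asend z ls P) = renames-++ (fvN-renN x y z) (fvC-renC x y P)
fvC-renC x y (arecv z P) = renames-++ (fvN-renN x y z) (fvC-renC x y P)
fvC-renC x y (run p ρ) = fvR-renR x y ρ
fvC-renC x y (closeP z) = fvN-renN x y z
fvC-renC x y (waitP z P) = renames-++ (fvN-renN x y z) (fvC-renC x y P)
fvC-renC x y (caseE z) = fvN-renN x y z
fvC-renC x y (link z A w) = renames-++ (fvN-renN x y z) (fvN-renN x y w)
fvC-renC x y (nu A P Q) = renames-++ (fvC-renC x y P) (fvC-renC x y Q)
fvC-renC x y (lett ls P Q) = renames-++ (fvC-renC x y P) (fvC-renC x y Q)

keys-++ : ∀ {B : Set} (Γ Δ : List (Atom × B)) → keys (Γ ++ Δ) ≡ keys Γ ++ keys Δ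
keys-++ Γ Δ = map-++ proj₁ Γ Δ

∈-keys-++⁻ : ∀ {B : Set} (Γ Δ : List (Atom × B)) {a} → a ∈ keys (Γ ++ Δ) → a ∈ keys Γ ⊎ a ∈ keys Δ
∈-keys-++⁻ Γ Δ a∈ = ∈-++⁻ (keys Γ) (subst (_ ∈_) (keys-++ Γ Δ) a∈)

∈-keys-++⁺ˡ : ∀ {B : Set} (Γ Δ : List (Atom × B)) {a} → a ∈ keys Γ → a ∈ keys (Γ ++ Δ)
∈-keys-++⁺ˡ Γ Δ a∈ = subst (_ ∈_) (sym (keys-++ Γ Δ)) (∈-++⁺ˡ a∈)

∈-keys-++⁺ʳ : ∀ {B : Set} (Γ Δ : List (Atom × B)) {a} → a ∈ keys Δ → a ∈ keys (Γ ++ Δ)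
∈-keys-++⁺ʳ Γ Δ a∈ = subst (_ ∈_) (sym (keys-++ Γ Δ)) (∈-++⁺ʳ (keys Γ) a∈)

∈-keys-snoc : ∀ (Γ : CCtx) x A → x ∈ keys (Γ ++ (x , A) ∷ [])
∈-keys-snoc Γ x A = ∈-keys-++⁺ʳ Γ _ (here refl)

∈-keys-snoc⁻ : ∀ (Γ : CCtx) x A {a} → a ∈ keys (Γ ++ (x , A) ∷ []) → a ∈ keys Γ ⊎ a ≡ x
∈-keys-snoc⁻ Γ x A a∈ with ∈-keys-++⁻ Γ _ a∈
... | inj₁ a∈Γ = inj₁ a∈Γ
... | inj₂ (here a≡x) = inj₂ a≡x

keys-snoc-retype : ∀ (Γ : CCtx) x A B → keys (Γ ++ (x , A) ∷ []) ≡ keys (Γ ++ (x , B) ∷ [])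
keys-snoc-retype Γ x A B = trans (keys-++ Γ _) (sym (keys-++ Γ _))

Unique-++⁻ : ∀ {A : Set} (xs : List A) {ys} → Unique (xs ++ ys)
           → Unique xs × Unique ys × (∀ {a} → a ∈ xs → a ∉ ys)
Unique-++⁻ [] u = [] , u , λ ()
Unique-++⁻ (x ∷ xs) (x∉ ∷ u) with Unique-++⁻ xs u
... | uxs , uys , xs#ys = AllP.++⁻ˡ xs x∉ ∷ uxs , uys , λ
  { (here refl) a∈ys → All.lookup x∉ (∈-++⁺ʳ xs a∈ys) refl
  ; (there a∈xs) → xs#ys a∈xs }

uniqK-++⁻ : ∀ (Γ Δ : CCtx) → UniqK (Γ ++ Δ) → UniqK Γ × UniqK Δ × Disj Γ Δ
uniqK-++⁻ Γ Δ u = Unique-++⁻ (keys Γ) (subst Unique (keys-++ Γ Δ) u)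

uniqK-++⁺ : ∀ (Γ Δ : CCtx) → UniqK Γ → UniqK Δ → Disj Γ Δ → UniqK (Γ ++ Δ)
uniqK-++⁺ Γ Δ uΓ uΔ Γ#Δ =
  subst Unique (sym (keys-++ Γ Δ)) (UniqueP.++⁺ uΓ uΔ λ (a∈Γ , a∈Δ) → Γ#Δ a∈Γ a∈Δ)

uniqK-snoc : ∀ (Γ : CCtx) x A → UniqK Γ → x ∉ keys Γ → UniqK (Γ ++ (x , A) ∷ [])
uniqK-snoc Γ x A u x∉Γ = uniqK-++⁺ Γ _ u ([] ∷ []) λ { a∈Γ (here refl) → x∉Γ a∈Γ }

uniqK-retype : ∀ (Γ : CCtx) x A B → UniqK (Γ ++ (x , A) ∷ []) → UniqK (Γ ++ (x , B) ∷ [])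
uniqK-retype Γ x A B = subst Unique (keys-snoc-retype Γ x A B)

-- Invariants of chop-free typing

⊢-uniqK : ∀ {Θ P Γ} → Θ ⊢[ false ] P ⦂ Γ → UniqK Γ
⊢-uniqK (ax x≢y _) = (x≢y ∷ []) ∷ [] ∷ []
⊢-uniqK (cut {Γ = Γ} {Δ = Δ} x y _ _ Γ#Δ _ dP dQ) =
  uniqK-++⁺ Γ Δ (proj₁ (uniqK-++⁻ Γ _ (⊢-uniqK dP))) (proj₁ (uniqK-++⁻ Δ _ (⊢-uniqK dQ))) Γ#Δ
⊢-uniqK (tensor {Γ = Γ} {Δ = Δ} {A = A} {B = B} {x = x} y _ x∉Γ Γ#Δ _ dP dQ) =
  uniqK-++⁺ Γ (Δ ++ (x , A ⊗ B) ∷ []) (proj₁ (uniqK-++⁻ Γ _ (⊢-uniqK dP)))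
    (uniqK-retype Δ x B _ (⊢-uniqK dQ)) Γ#Δx
  where
  Γ#Δx : Disj Γ (Δ ++ (x , A ⊗ B) ∷ [])
  Γ#Δx a∈Γ a∈Δx with ∈-keys-snoc⁻ Δ x _ a∈Δx
  ... | inj₁ a∈Δ = Γ#Δ a∈Γ a∈Δ
  ... | inj₂ refl = x∉Γ a∈Γ
⊢-uniqK (par {Γ = Γ} {x = x} y _ d) with uniqK-++⁻ Γ _ (⊢-uniqK d)
... | uΓ , _ , Γ#yx = uniqK-snoc Γ x _ uΓ λ x∈Γ → Γ#yx x∈Γ (there (here refl))
⊢-uniqK (plus₁ {Γ = Γ} {x = x} _ d) = uniqK-retype Γ x _ _ (⊢-uniqK d)
⊢-uniqK (plus₂ {Γ = Γ} {x = x} _ d) = uniqK-retype Γ x _ _ (⊢-uniqK d)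
⊢-uniqK (with& {Γ = Γ} {x = x} d _) = uniqK-retype Γ x _ _ (⊢-uniqK d)
⊢-uniqK (why {Γ = Γ} {x = x} y _ x∉Γ d) = uniqK-snoc Γ x _ (proj₁ (uniqK-++⁻ Γ _ (⊢-uniqK d))) x∉Γ
⊢-uniqK (bang {Γ = Γ} {x = x} y _ x∉Γ _ d) = uniqK-snoc Γ x _ (proj₁ (uniqK-++⁻ Γ _ (⊢-uniqK d))) x∉Γ
⊢-uniqK (ex∃ {Γ = Γ} {x = x} _ _ d) = uniqK-retype Γ x _ _ (⊢-uniqK d)
⊢-uniqK (all∀ {Γ = Γ} {x = x} X _ _ _ _ d) = uniqK-retype Γ x _ _ (⊢-uniqK d)
⊢-uniqK (weaken {Γ = Γ} {x = x} x∉Γ _ d) = uniqK-snoc Γ x _ (⊢-uniqK d) x∉Γ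
⊢-uniqK (contract {Γ = Γ} {x = x} x∉Γ d) = uniqK-snoc Γ x _ (proj₁ (uniqK-++⁻ Γ _ (⊢-uniqK d))) x∉Γ
⊢-uniqK one = [] ∷ []
⊢-uniqK (bot {Γ = Γ} {x = x} x∉Γ d) = uniqK-snoc Γ x _ (⊢-uniqK d) x∉Γ
⊢-uniqK (top {Γ = Γ} {x = x} _ _ uΓ _ x∉Γ) = uniqK-snoc Γ x _ uΓ x∉Γ
⊢-uniqK (idP ρ _ _ u) = u
⊢-uniqK (sendR ys _ _ _ _ _) = [] ∷ []
⊢-uniqK (recvR {Γ = Γ} {x = x} p _ x∉Γ d) = uniqK-snoc Γ x _ (⊢-uniqK d) x∉Γ
⊢-uniqK (exch _ Γ↭Γ' d) = Unique-resp-↭ (↭⇒↭ₛ (↭-map⁺ proj₁ Γ↭Γ')) (⊢-uniqK d)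

⊢-wfE : ∀ {Θ P Γ} → Θ ⊢[ false ] P ⦂ Γ → WfE Θ
⊢-wfE (ax _ _) = []
⊢-wfE (cut x y _ _ _ _ dP dQ) = AllP.++⁺ (⊢-wfE dP) (⊢-wfE dQ)
⊢-wfE (tensor y _ _ _ _ dP dQ) = AllP.++⁺ (⊢-wfE dP) (⊢-wfE dQ)
⊢-wfE (par y _ d) = ⊢-wfE d
⊢-wfE (plus₁ _ d) = ⊢-wfE d
⊢-wfE (plus₂ _ d) = ⊢-wfE d
⊢-wfE (with& d _) = ⊢-wfE d
⊢-wfE (why y _ _ d) = ⊢-wfE d
⊢-wfE (bang y _ _ _ d) = []
⊢-wfE (ex∃ _ _ d) = ⊢-wfE d
⊢-wfE (all∀ X _ _ _ _ d) = ⊢-wfE d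
⊢-wfE (weaken _ _ d) = ⊢-wfE d
⊢-wfE (contract _ d) = ⊢-wfE d
⊢-wfE one = []
⊢-wfE (bot _ d) = ⊢-wfE d
⊢-wfE (top _ w _ _ _) = w
⊢-wfE (idP ρ w _ _) = w ∷ []
⊢-wfE (sendR ys _ _ _ _ d) = ⊢-wfE d
⊢-wfE (recvR {Θ = Θ} p _ _ d) = AllP.++⁻ˡ Θ (⊢-wfE d)
⊢-wfE (exch Θ↭Θ' _ d) = All-resp-↭ Θ↭Θ' (⊢-wfE d)

++-⊆ : ∀ {A B C : List Atom} → A ⊆ C → B ⊆ C → A ++ B ⊆ C
++-⊆ {A} A⊆C B⊆C a∈ with ∈-++⁻ A a∈
... | inj₁ a∈A = A⊆C a∈A
... | inj₂ a∈B = B⊆C a∈B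

⊆keys-unopen : ∀ {P x} (Γ : CCtx) A → x ∉ fvC P
             → fvC (P ^ x) ⊆ keys (Γ ++ (x , A) ∷ []) → fvC P ⊆ keys Γ
⊆keys-unopen {P} {x} Γ A x∉P P^x⊆ a∈P with ∈-keys-snoc⁻ Γ x A (P^x⊆ (fvC-openC 0 (x ∷ []) P a∈P))
... | inj₁ a∈Γ = a∈Γ
... | inj₂ refl = ⊥-elim (x∉P a∈P)

⊆keys-snoc : ∀ {L} (Γ : CCtx) x B → L ⊆ keys Γ → x ∷ L ⊆ keys (Γ ++ (x , B) ∷ [])
⊆keys-snoc Γ x B L⊆Γ = ∈-∷⁺ʳ (∈-keys-snoc Γ x B) (λ a∈L → ∈-keys-++⁺ˡ Γ _ (L⊆Γ a∈L))

⊆keys-retype : ∀ {L} (Γ : CCtx) x A B → L ⊆ keys (Γ ++ (x , A) ∷ []) → x ∷ L ⊆ keys (Γ ++ (x , B) ∷ [])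
⊆keys-retype Γ x A B L⊆ = ∈-∷⁺ʳ (∈-keys-snoc Γ x B) (λ a∈L → subst (_ ∈_) (keys-snoc-retype Γ x A B) (L⊆ a∈L))

fvR-fvRec : ∀ ρ → fvR (fvRec ρ) ≡ map proj₂ ρ
fvR-fvRec [] = refl
fvR-fvRec ((l , x) ∷ ρ) = cong (x ∷_) (fvR-fvRec ρ)

keys-· : ∀ {Δ ρ Γ} → Δ · ρ ≡ Γ → keys Γ ≡ map proj₂ ρ
keys-· [] = refl
keys-· (step {x = x} Δρ≡Γ) = cong (x ∷_) (keys-· Δρ≡Γ)

-- zip truncates, so the atoms opened in x[λρ.P] may run past the record into surplus ws.
·-zip⁻ : ∀ {Δ Γρ} ls ys → Δ · zip ls ys ≡ Γρ
       → ∃ λ ws → ys ≡ keys Γρ ++ ws × len (keys Γρ) ≤ len ls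
·-zip⁻ [] ys [] = ys , refl , z≤n
·-zip⁻ (l ∷ ls) [] [] = [] , refl , z≤n
·-zip⁻ (l ∷ ls) (y ∷ ys) (step Δρ≡Γρ) with ·-zip⁻ ls ys Δρ≡Γρ
... | ws , ys≡ , ≤ls = ws , cong (y ∷_) ys≡ , s≤s ≤ls

⊢-fv⊆keys : ∀ {Θ P Γ} → Θ ⊢[ false ] P ⦂ Γ → fvC P ⊆ keys Γ
⊢-fv⊆keys (ax _ _) = λ a∈ → a∈
⊢-fv⊆keys (cut {Γ = Γ} {Δ = Δ} {A = A} {P = P} {Q = Q} x y x∉P y∉Q _ _ dP dQ) =
  ++-⊆ {fvC P} (λ a∈ → ∈-keys-++⁺ˡ Γ Δ (⊆keys-unopen {P} Γ A x∉P (⊢-fv⊆keys dP) a∈))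
               (λ a∈ → ∈-keys-++⁺ʳ Γ Δ (⊆keys-unopen {Q} Δ _ y∉Q (⊢-fv⊆keys dQ) a∈))
⊢-fv⊆keys (tensor {Γ = Γ} {Δ = Δ} {A = A} {B = B} {P = P} {x = x} y y∉P _ _ _ dP dQ) =
  ∈-∷⁺ʳ (∈-keys-++⁺ʳ Γ _ (∈-keys-snoc Δ x _))
    (++-⊆ {fvC P} (λ a∈ → ∈-keys-++⁺ˡ Γ _ (⊆keys-unopen {P} Γ A y∉P (⊢-fv⊆keys dP) a∈))
                  (λ a∈ → ∈-keys-++⁺ʳ Γ _ (⊆keys-retype Δ x B (A ⊗ B) (⊢-fv⊆keys dQ) (there a∈))))
⊢-fv⊆keys (par {Γ = Γ} {P = P} {x = x} y y∉P d) (here refl) = ∈-keys-snoc Γ x _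
⊢-fv⊆keys (par {Γ = Γ} {P = P} {x = x} y y∉P d) (there a∈P)
  with ∈-keys-++⁻ Γ _ (⊢-fv⊆keys d (fvC-openC 0 (y ∷ []) P a∈P))
... | inj₁ a∈Γ = ∈-keys-++⁺ˡ Γ _ a∈Γ
... | inj₂ (here refl) = ⊥-elim (y∉P a∈P)
... | inj₂ (there (here refl)) = ∈-keys-snoc Γ x _
⊢-fv⊆keys (plus₁ {Γ = Γ} {x = x} _ d) = ⊆keys-retype Γ x _ _ (⊢-fv⊆keys d)
⊢-fv⊆keys (plus₂ {Γ = Γ} {x = x} _ d) = ⊆keys-retype Γ x _ _ (⊢-fv⊆keys d)
⊢-fv⊆keys (with& {Γ = Γ} {P = P} {x = x} dP dQ) =
  ∈-∷⁺ʳ (∈-keys-snoc Γ x _)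
    (++-⊆ {fvC P} (λ a∈ → ⊆keys-retype Γ x _ _ (⊢-fv⊆keys dP) (there a∈))
                  (λ a∈ → ⊆keys-retype Γ x _ _ (⊢-fv⊆keys dQ) (there a∈)))
⊢-fv⊆keys (why {Γ = Γ} {A = A} {P = P} {x = x} y y∉P _ d) = ⊆keys-snoc Γ x _ (⊆keys-unopen {P} Γ A y∉P (⊢-fv⊆keys d))
⊢-fv⊆keys (bang {Γ = Γ} {A = A} {P = P} {x = x} y y∉P _ _ d) = ⊆keys-snoc Γ x _ (⊆keys-unopen {P} Γ A y∉P (⊢-fv⊆keys d))
⊢-fv⊆keys (ex∃ {Γ = Γ} {x = x} _ _ d) = ⊆keys-retype Γ x _ _ (⊢-fv⊆keys d)
⊢-fv⊆keys (all∀ {Γ = Γ} {P = P} {x = x} X _ _ _ _ d) =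
  ⊆keys-retype Γ x _ _ (λ a∈ → ⊢-fv⊆keys d (subst (_ ∈_) (sym (fvC-openTP 0 (var (fv X)) P)) a∈))
⊢-fv⊆keys (weaken {Γ = Γ} _ _ d) a∈ = ∈-keys-++⁺ˡ Γ _ (⊢-fv⊆keys d a∈)
⊢-fv⊆keys (contract {Γ = Γ} {P = P} {x = x} {y = y} {z = z} _ d) a∈ with fvC-renC x y (renC x z P) a∈
... | inj₁ refl = ∈-keys-snoc Γ x _
... | inj₂ (a≢y , a∈′) with fvC-renC x z P a∈′
...   | inj₁ refl = ∈-keys-snoc Γ x _
...   | inj₂ (a≢z , a∈P) with ∈-keys-++⁻ Γ _ (⊢-fv⊆keys d a∈P)
...     | inj₁ a∈Γ = ∈-keys-++⁺ˡ Γ _ a∈Γ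
...     | inj₂ (here a≡y) = ⊥-elim (a≢y a≡y)
...     | inj₂ (there (here a≡z)) = ⊥-elim (a≢z a≡z)
⊢-fv⊆keys one = λ a∈ → a∈
⊢-fv⊆keys (bot {Γ = Γ} {x = x} _ d) = ⊆keys-snoc Γ x _ (⊢-fv⊆keys d)
⊢-fv⊆keys (top {Γ = Γ} {x = x} _ _ _ _ _) = ⊆keys-snoc Γ x _ (λ ())
⊢-fv⊆keys (idP ρ _ Δρ≡Γ _) a∈ = subst (_ ∈_) (trans (fvR-fvRec ρ) (sym (keys-· Δρ≡Γ))) a∈
⊢-fv⊆keys (sendR {ls = ls} {P = P} ys _ _ ys∉P Δρ≡Γρ d) with ·-zip⁻ ls ys Δρ≡Γρ
... | ws , refl , _ = ∈-∷⁺ʳ (here refl) λ a∈P →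
  ⊥-elim (All.lookup ys∉P (∈-++⁺ˡ (⊢-fv⊆keys d (fvC-openC 0 _ P a∈P))) a∈P)
⊢-fv⊆keys (recvR {Γ = Γ} {P = P} {x = x} p _ _ d) =
  ⊆keys-snoc Γ x _ (λ a∈ → ⊢-fv⊆keys d (subst (_ ∈_) (sym (fvC-openPV 0 p P)) a∈))
⊢-fv⊆keys (exch _ Γ↭Γ' d) a∈ = ∈-resp-↭ (↭-map⁺ proj₁ Γ↭Γ') (⊢-fv⊆keys d a∈)

lcR-fvRec : ∀ n ρ → lcR n (fvRec ρ)
lcR-fvRec n [] = tt
lcR-fvRec n ((l , x) ∷ ρ) = tt , lcR-fvRec n ρ

⊢-lcC : ∀ {Θ P Γ} → Θ ⊢[ false ] P ⦂ Γ → lcC 0 P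
⊢-lcC (ax _ _) = tt , tt
⊢-lcC (cut {P = P} {Q = Q} x y _ _ _ _ dP dQ) =
  lcC-openC⁻ 0 (x ∷ []) [] P (⊢-lcC dP) (λ ()) , lcC-openC⁻ 0 (y ∷ []) [] Q (⊢-lcC dQ) (λ ())
⊢-lcC (tensor {P = P} y _ _ _ _ dP dQ) = tt , lcC-openC⁻ 0 (y ∷ []) [] P (⊢-lcC dP) (λ ()) , ⊢-lcC dQ
⊢-lcC (par {P = P} y _ d) = tt , lcC-openC⁻ 0 (y ∷ []) [] P (⊢-lcC d) (λ ())
⊢-lcC (plus₁ _ d) = tt , ⊢-lcC d
⊢-lcC (plus₂ _ d) = tt , ⊢-lcC d
⊢-lcC (with& dP dQ) = tt , ⊢-lcC dP , ⊢-lcC dQ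
⊢-lcC (why {P = P} y _ _ d) = tt , lcC-openC⁻ 0 (y ∷ []) [] P (⊢-lcC d) (λ ())
⊢-lcC (bang {P = P} y _ _ _ d) = tt , lcC-openC⁻ 0 (y ∷ []) [] P (⊢-lcC d) (λ ())
⊢-lcC (ex∃ _ _ d) = tt , ⊢-lcC d
⊢-lcC (all∀ {P = P} X _ _ _ _ d) = tt , subst id (lcC-openTP 0 0 (var (fv X)) P) (⊢-lcC d)
⊢-lcC (weaken _ _ d) = ⊢-lcC d
⊢-lcC (contract {P = P} {x = x} {y = y} {z = z} _ d) =
  subst id (sym (trans (lcC-renC 0 x y (renC x z P)) (lcC-renC 0 x z P))) (⊢-lcC d)
⊢-lcC one = tt
⊢-lcC (bot _ d) = tt , ⊢-lcC d
⊢-lcC (top _ _ _ _ _) = tt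
⊢-lcC (idP ρ _ _ _) = lcR-fvRec 0 ρ
⊢-lcC (sendR {Γρ = Γρ} {ls = ls} {P = P} ys _ uys _ Δρ≡Γρ d) with ·-zip⁻ ls ys Δρ≡Γρ
... | ws , refl , ≤ls = tt , lcC-mono P (lcC-openC⁻ 0 (keys Γρ) ws P (⊢-lcC d) ws#P) (≤-trans ≤ls (m≤m+n (len ls) 0))
  where
  ws#P : Disjoint ws (fvC (openC 0 (keys Γρ ++ ws) P))
  ws#P (w∈ws , w∈P) = proj₂ (proj₂ (Unique-++⁻ (keys Γρ) uys)) (⊢-fv⊆keys d w∈P) w∈ws
⊢-lcC (recvR {P = P} p _ _ d) = tt , subst id (lcC-openPV 0 0 p P) (⊢-lcC d)
⊢-lcC (exch _ _ d) = ⊢-lcC d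

⊢-lcPV : ∀ {Θ P Γ} → Θ ⊢[ false ] P ⦂ Γ → lcPV 0 P
⊢-lcPV (ax _ _) = tt
⊢-lcPV (cut {P = P} {Q = Q} x y _ _ _ _ dP dQ) =
  subst id (lcPV-openC 0 0 (x ∷ []) P) (⊢-lcPV dP) , subst id (lcPV-openC 0 0 (y ∷ []) Q) (⊢-lcPV dQ)
⊢-lcPV (tensor {P = P} y _ _ _ _ dP dQ) = subst id (lcPV-openC 0 0 (y ∷ []) P) (⊢-lcPV dP) , ⊢-lcPV dQ
⊢-lcPV (par {P = P} y _ d) = subst id (lcPV-openC 0 0 (y ∷ []) P) (⊢-lcPV d)
⊢-lcPV (plus₁ _ d) = ⊢-lcPV d
⊢-lcPV (plus₂ _ d) = ⊢-lcPV d
⊢-lcPV (with& dP dQ) = ⊢-lcPV dP , ⊢-lcPV dQ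
⊢-lcPV (why {P = P} y _ _ d) = subst id (lcPV-openC 0 0 (y ∷ []) P) (⊢-lcPV d)
⊢-lcPV (bang {P = P} y _ _ _ d) = subst id (lcPV-openC 0 0 (y ∷ []) P) (⊢-lcPV d)
⊢-lcPV (ex∃ _ _ d) = ⊢-lcPV d
⊢-lcPV (all∀ {P = P} X _ _ _ _ d) = subst id (lcPV-openTP 0 0 (var (fv X)) P) (⊢-lcPV d)
⊢-lcPV (weaken _ _ d) = ⊢-lcPV d
⊢-lcPV (contract {P = P} {x = x} {y = y} {z = z} _ d) =
  subst id (sym (trans (lcPV-renC 0 x y (renC x z P)) (lcPV-renC 0 x z P))) (⊢-lcPV d)
⊢-lcPV one = tt
⊢-lcPV (bot _ d) = ⊢-lcPV d
⊢-lcPV (top _ _ _ _ _) = tt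
⊢-lcPV (idP ρ _ _ _) = tt
⊢-lcPV (sendR {P = P} ys _ _ _ _ d) = subst id (lcPV-openC 0 0 ys P) (⊢-lcPV d)
⊢-lcPV (recvR {P = P} p _ _ d) = lcPV-openPV⁻ 0 p P (⊢-lcPV d)
⊢-lcPV (exch _ _ d) = ⊢-lcPV d

-- Eliminating Chop

freshAtom : (L : List Atom) → ∃ λ a → a ∉ L
freshAtom L = suc (max 0 L) , λ a∈L → <-irrefl refl (All.lookup (xs≤max 0 L) a∈L)

len-map-proj : ∀ {A B : Set} (ρ : List (A × B)) → len (map proj₂ ρ) ≡ len (map proj₁ ρ)
len-map-proj [] = refl
len-map-proj (_ ∷ ρ) = cong suc (len-map-proj ρ)

·-unzip : ∀ {Δ ρ Γ} → Δ · ρ ≡ Γ → Δ · zip (map proj₁ ρ) (map proj₂ ρ) ≡ Γ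
·-unzip [] = []
·-unzip (step Δρ≡Γ) = step (·-unzip Δρ≡Γ)

-- x[λρ.P] and y(p).Q, with the channel x resp. y as the outermost bound index.
sendAbs : List (Label × Atom) → Proc → Proc
sendAbs ρ P = asend (bv 0) (map proj₁ ρ) (closeC 0 (map proj₂ ρ) P)

recvAbs : Atom → Proc → Proc
recvAbs p Q = arecv (bv 0) (closePV 0 p Q)

⊢-sendAbs : ∀ {Θ Δ ρ Δρ P} x → WfL 0 Δ → Δ · ρ ≡ Δρ → Θ ⊢[ false ] P ⦂ Δρ
          → Θ ⊢[ false ] sendAbs ρ P ^ x ⦂ [] ++ (x , send Δ) ∷ []
⊢-sendAbs {Θ} {Δ} {ρ} {Δρ} {P} x wfΔ Δ·ρ ⊢P =
  subst (λ P′ → Θ ⊢[ false ] asend (fv x) ls P′ ⦂ (x , send Δ) ∷ []) (sym open-x-id)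
    (sendR ys wfΔ unique-ys ys∉P′ (·-unzip Δ·ρ)
      (subst (λ R → Θ ⊢[ false ] R ⦂ Δρ) (sym (openC-closeC 0 ys P (⊢-lcC ⊢P))) ⊢P))
  where
  ls : List Label
  ls = map proj₁ ρ
  ys : List Atom
  ys = map proj₂ ρ
  unique-ys : Unique ys
  unique-ys = subst Unique (keys-· Δ·ρ) (⊢-uniqK ⊢P)
  ys∉P′ : All (_∉ fvC (closeC 0 ys P)) ys
  ys∉P′ = All.tabulate λ y∈ys y∈P′ → closeC-fresh 0 ys P (y∈ys , y∈P′)
  open-x-id : openC (len ls + 0) (x ∷ []) (closeC 0 ys P) ≡ closeC 0 ys P
  open-x-id = openC-id (x ∷ []) (closeC 0 ys P) (closeC-lcC 0 ys P (⊢-lcC ⊢P))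
                (≤-trans (≤-reflexive (len-map-proj ρ)) (m≤m+n (len ls) 0))

⊢-recvAbs : ∀ {Θ' Δ Γ p Q} y → y ∉ keys Γ → Θ' ++ (p , Δ) ∷ [] ⊢[ false ] Q ⦂ Γ
          → Θ' ⊢[ false ] recvAbs p Q ^ y ⦂ Γ ++ (y , recv Δ) ∷ []
⊢-recvAbs {Θ'} {Δ} {Γ} {p} {Q} y y∉Γ ⊢Q =
  subst (λ Q′ → Θ' ⊢[ false ] arecv (fv y) Q′ ⦂ Γ ++ (y , recv Δ) ∷ []) (sym open-y-id)
    (recvR p (closePV-fresh 0 p Q) y∉Γ
      (subst (λ R → Θ' ++ (p , Δ) ∷ [] ⊢[ false ] R ⦂ Γ) (sym (openPV-closePV 0 p Q (⊢-lcPV ⊢Q))) ⊢Q))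
  where
  open-y-id : openC 0 (y ∷ []) (closePV 0 p Q) ≡ closePV 0 p Q
  open-y-id = openC-id (y ∷ []) (closePV 0 p Q) (subst id (sym (lcC-closePV 0 0 p Q)) (⊢-lcC ⊢Q)) z≤n

theorem4p5 : ∀ {Θ Θ' : PEnv} {Δ : LCtx} {ρ : List (Label × Atom)} {Δρ Γ : CCtx}
               {p : Atom} {P Q : Proc}
             → Δ · ρ ≡ Δρ
             → Θ ⊢[ false ] P ⦂ Δρ
             → Θ' ++ (p , Δ) ∷ [] ⊢[ false ] Q ⦂ Γ
             → Disj Θ Θ'
             → ∃ λ R → Θ ++ Θ' ⊢[ false ] R ⦂ Γ
theorem4p5 {Θ' = Θ'} {Δ} {ρ} {Γ = Γ} {p} {P} {Q} Δ·ρ ⊢P ⊢Q Θ#Θ' =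
  nu (send Δ) (sendAbs ρ P) (recvAbs p Q) ,
  cut x y x∉ (y∉ ∘ ∈-++⁺ˡ) (λ ()) Θ#Θ' (⊢-sendAbs x wfΔ Δ·ρ ⊢P) (⊢-recvAbs y (y∉ ∘ ∈-++⁺ʳ _) ⊢Q)
  where
  wfΔ : WfL 0 Δ
  wfΔ = All.head (AllP.++⁻ʳ Θ' (⊢-wfE ⊢Q))
  x : Atom
  x = proj₁ (freshAtom (fvC (sendAbs ρ P)))
  x∉ : x ∉ fvC (sendAbs ρ P)
  x∉ = proj₂ (freshAtom (fvC (sendAbs ρ P)))
  y : Atom
  y = proj₁ (freshAtom (fvC (recvAbs p Q) ++ keys Γ))
  y∉ : y ∉ fvC (recvAbs p Q) ++ keys Γ
  y∉ = proj₂ (freshAtom (fvC (recvAbs p Q) ++ keys Γ))
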